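{- Let $\varphi$ be a $\mathcal{GML}$ formula over a finite set $\mathsf{PROP}$ of propositional symbols of modal depth at most $L$. The following are equivalent: (1) $\varphi$ is preserved under embeddings, i.e. whenever $(\mathfrak{M},w)\models\varphi$ and there is an embedding from $(\mathfrak{M},w)$ to $(\mathfrak{N},v)$, then $(\mathfrak{N},v)\models\varphi$; (2) $\varphi$ is equivalent (over finite pointed models) to an $\exists\mathcal{GML}$ formula of modal depth at most $L$.
   Context: All Kripke models are finite: $\mathfrak{M}=(W,R,V)$, $W$ non-empty finite, $R\subseteq W\times W$, $V:\mathsf{PROP}\to 2^W$; a pointed model is $(\mathfrak{M},w)$, $w\in W$. An embedding from $(\mathfrak{M},w)$ to $(\mathfrak{N},v)$, $\mathfrak{N}=(W',R',V')$, is an injective $f:W\to W'$ with $f(w)=v$ such that $uRz$ iff $f(u)R'f(z)$ and $u\in V(p)$ iff $f(u)\in V'(p)$ for all $u,z\in W$, $p\in\mathsf{PROP}$. $\mathcal{GML}$: $\varphi::=p\mid\neg\varphi\mid\varphi\wedge\varphi\mid\varphi\vee\varphi\mid\Diamond^{\ge k}\varphi$ ($k\ge1$), $(\mathfrak{M},w)\models\Diamond^{\ge k}\varphi$ iff at least $k$ worlds $u$ with $wRu$ satisfy $\varphi$. Modal depth = maximal nesting of $\Diamond^{\ge k}$. $\exists\mathcal{GML}$: the fragment where negation occurs only directly in front of propositional symbols. Two formulae are equivalent if they are satisfied by the same finite pointed models. -}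

module Defs where

open import Data.Nat using (ℕ; zero; suc; _≤_; _⊔_; _+_; _≤ᵇ_)
open import Data.Fin using (Fin)
import Data.Fin as Fin
open import Data.Bool using (Bool; true; false; not; _∧_; _∨_; if_then_else_)
open import Data.Product using (Σ; _×_)
open import Relation.Binary.PropositionalEquality using (_≡_)
open import Function.Definitions using (Injective)

data GML (P : ℕ) : Set where
  atom : Fin P → GML P
  neg  : GML P → GML P
  conj : GML P → GML P → GML P
  disj : GML P → GML P → GML P
  dia  : (k : ℕ) → 1 ≤ k → GML P → GML P

depth : ∀ {P} → GML P → ℕ
depth (atom p)     = 0
depth (neg φ)      = depth φ
depth (conj φ ψ)   = depth φ ⊔ depth ψ
depth (disj φ ψ)   = depth φ ⊔ depth ψ
depth (dia k _ φ)  = suc (depth φ)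

data Existential {P : ℕ} : GML P → Set where
  ex-atom : ∀ p → Existential (atom p)
  ex-neg  : ∀ p → Existential (neg (atom p))
  ex-conj : ∀ {φ ψ} → Existential φ → Existential ψ → Existential (conj φ ψ)
  ex-disj : ∀ {φ ψ} → Existential φ → Existential ψ → Existential (disj φ ψ)
  ex-dia  : ∀ {k} (h : 1 ≤ k) {φ} → Existential φ → Existential (dia k h φ)

-- Finite Kripke model: W = Fin (suc n) (non-empty), R and V decidable (Bool-valued)
record Model (P : ℕ) : Set where
  field
    size : ℕ
    R    : Fin (suc size) → Fin (suc size) → Bool
    V    : Fin P → Fin (suc size) → Bool
open Model public

World : ∀ {P} → Model P → Set
World M = Fin (suc (size M))

countTrue : ∀ {m} → (Fin m → Bool) → ℕ
countTrue {zero}  f = 0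
countTrue {suc m} f = (if f Fin.zero then 1 else 0) + countTrue (λ i → f (Fin.suc i))

sat : ∀ {P} (M : Model P) → GML P → World M → Bool
sat M (atom p)    w = V M p w
sat M (neg φ)     w = not (sat M φ w)
sat M (conj φ ψ)  w = sat M φ w ∧ sat M ψ w
sat M (disj φ ψ)  w = sat M φ w ∨ sat M ψ w
sat M (dia k _ φ) w = k ≤ᵇ countTrue (λ u → R M w u ∧ sat M φ u)

_⊨_at_ : ∀ {P} (M : Model P) → GML P → World M → Set
M ⊨ φ at w = sat M φ w ≡ true

record Embedding {P} (M : Model P) (w : World M) (N : Model P) (v : World N) : Set where
  field
    f        : World M → World N
    f-inj    : Injective _≡_ _≡_ f
    f-point  : f w ≡ v
    f-R      : ∀ u z → R M u z ≡ R N (f u) (f z)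
    f-V      : ∀ p u → V M p u ≡ V N p (f u)

PreservedUnderEmbeddings : ∀ {P} → GML P → Set
PreservedUnderEmbeddings {P} φ =
  ∀ (M : Model P) (w : World M) (N : Model P) (v : World N) →
    Embedding M w N v → M ⊨ φ at w → N ⊨ φ at v

Equivalent : ∀ {P} → GML P → GML P → Set
Equivalent {P} φ ψ = ∀ (M : Model P) (w : World M) → sat M φ w ≡ sat M ψ w

{-# OPTIONS --safe #-}
-- Existential formulas are preserved by homomorphisms that are injective on the successors of
-- each world, in particular by embeddings.
--
-- Conversely, let φ be preserved and let B be the sum of the grades k of the subformulas ◇≥k χ
-- of φ. Take ψ to be the disjunction of the diagrams of all trees of height L and branching at
-- most B whose root satisfies φ. The diagram of a tree t says that, at the current world w, the
-- children of t can be matched to distinct successors satisfying their own diagrams in the sense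
-- of Hall's condition, so by Hall's theorem it yields a locally injective homomorphism from t
-- sending the root to w. If M ⊨ φ at w, unravelling M from w while keeping, for every
-- ◇≥k χ of φ, only the first k χ-successors gives such a tree which still satisfies φ, and its
-- diagram holds at w. If M ⊨ ψ at w, some tree t satisfying φ maps into M at w; gluing t to M
-- along that map yields a model into which t embeds and which maps onto M bijectively on
-- successors, so it agrees with M on all of GML, and φ transfers from t to M at w.
module Submission where

open import Defs
open import Algebra.Bundles using (CommutativeMonoid)
open import Data.Bool using (Bool; true; false; not; _∧_; _∨_; if_then_else_)
open import Data.Bool.Properties
  using (∧-identityʳ; ∧-zeroʳ; ∨-zeroʳ; ∧-distribʳ-∨; ∨-commutativeMonoid; T-≡; ⇔→≡)
import Data.Bool.Properties as Bool
open import Data.Empty using (⊥; ⊥-elim)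
open import Data.Fin using (Fin; zero; suc; _↑ˡ_; _↑ʳ_; splitAt)
open import Data.Fin.Properties
  using (_≟_; suc-injective; all?; splitAt-↑ˡ; splitAt-↑ʳ; splitAt⁻¹-↑ˡ; splitAt⁻¹-↑ʳ; ↑ˡ-injective)
open import Data.Fin.Subset.Properties using (anySubset?)
open import Data.List using (List; []; _∷_; length; cartesianProductWith; filter)
import Data.List as List
open import Data.List.Membership.Propositional using (_∈_; lose; find)
open import Data.List.Membership.Propositional.Properties
  using (∈-map⁺; ∈-++⁺ˡ; ∈-++⁺ʳ; ∈-cartesianProductWith⁺; ∈-filter⁺; ∈-filter⁻)
open import Data.List.Relation.Unary.All using (All; []; _∷_)
import Data.List.Relation.Unary.All as All
import Data.List.Relation.Unary.All.Properties as Allₚ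
open import Data.List.Relation.Unary.Any using (Any; here; there)
import Data.List.Relation.Unary.Any.Properties as Anyₚ
open import Data.Nat using (ℕ; zero; suc; _+_; _∸_; _≤_; _<_; _≤ᵇ_; _⊓_; z≤n; s≤s; s≤s⁻¹; _≤?_; _<?_)
open import Data.Nat.ListAction using (sum)
open import Data.Nat.Properties
  using (≤-refl; ≤-reflexive; ≤-trans; ≤-antisym; +-comm; +-assoc; +-suc; +-identityʳ; +-mono-≤; +-monoˡ-≤;
         +-cancelˡ-≤; ≤ᵇ⇒≤; ≤⇒≤ᵇ; ≰⇒>; ⊔-lub; m⊔n≤o⇒m≤o; m⊔n≤o⇒n≤o; m≤n⇒m⊓n≡m; m⊓n≤m; ⊓-zeroʳ;
         +-commutativeSemigroup; module ≤-Reasoning)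
open import Data.Product using (Σ; ∃; _×_; _,_; proj₁; proj₂)
open import Data.Sum using (_⊎_; inj₁; inj₂; [_,_]′)
open import Data.Unit using (⊤; tt)
open import Data.Vec using (Vec; []; _∷_; lookup; tabulate)
open import Data.Vec.Properties using (lookup∘tabulate)
open import Function using (_∘_; case_of_)
open import Function.Bundles using (_⇔_; mk⇔; Equivalence)
open import Relation.Binary.PropositionalEquality
  using (_≡_; _≢_; refl; sym; trans; cong; cong₂; subst; subst₂; module ≡-Reasoning)
open import Relation.Nullary using (¬_; yes; no; does)
open import Relation.Nullary.Decidable using (Dec; dec-true; dec-false; _×-dec_; _→-dec_)

open import Algebra.Properties.CommutativeSemigroup +-commutativeSemigroup using (interchange)
open import Algebra.Properties.CommutativeSemigroup (CommutativeMonoid.commutativeSemigroup ∨-commutativeMonoid)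
  renaming (interchange to ∨-interchange)

∧-true⁻ˡ : ∀ {a b} → a ∧ b ≡ true → a ≡ true
∧-true⁻ˡ {true} _ = refl

∧-true⁻ʳ : ∀ {a b} → a ∧ b ≡ true → b ≡ true
∧-true⁻ʳ {true} e = e

∧-true⁺ : ∀ {a b} → a ≡ true → b ≡ true → a ∧ b ≡ true
∧-true⁺ refl refl = refl

∨-true⁺ˡ : ∀ {a b} → a ≡ true → a ∨ b ≡ true
∨-true⁺ˡ refl = refl

∨-true⁺ʳ : ∀ {a b} → b ≡ true → a ∨ b ≡ true
∨-true⁺ʳ {a} refl = ∨-zeroʳ a

∨-true⁻ : ∀ {a b} → a ∨ b ≡ true → a ≡ true ⊎ b ≡ true
∨-true⁻ {true} _ = inj₁ refl
∨-true⁻ {false} e = inj₂ e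

not-true⁻ : ∀ {a} → not a ≡ true → a ≡ false
not-true⁻ {false} _ = refl

true≢false : ∀ {a} → a ≡ true → a ≡ false → ⊥
true≢false refl ()

≤ᵇ-true⁺ : ∀ {m n} → m ≤ n → (m ≤ᵇ n) ≡ true
≤ᵇ-true⁺ m≤n = Equivalence.to T-≡ (≤⇒≤ᵇ m≤n)

≤ᵇ-true⁻ : ∀ {m n} → (m ≤ᵇ n) ≡ true → m ≤ n
≤ᵇ-true⁻ {m} {n} e = ≤ᵇ⇒≤ m n (Equivalence.from T-≡ e)

≤ᵇ-threshold : ∀ {k a b} → a ≤ b → (k ≤ b → k ≤ a) → (k ≤ᵇ a) ≡ (k ≤ᵇ b)
≤ᵇ-threshold {k} a≤b k≤b⇒k≤a =
  ⇔→≡ {z = true} (mk⇔ (λ e → ≤ᵇ-true⁺ (≤-trans (≤ᵇ-true⁻ {k} e) a≤b)) (λ e → ≤ᵇ-true⁺ (k≤b⇒k≤a (≤ᵇ-true⁻ e))))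

_≡ᵇ_ : ∀ {m} → Fin m → Fin m → Bool
i ≡ᵇ j = does (i ≟ j)

≡ᵇ-refl : ∀ {m} (i : Fin m) → (i ≡ᵇ i) ≡ true
≡ᵇ-refl i = dec-true (i ≟ i) refl

≡ᵇ⇒≡ : ∀ {m} {i j : Fin m} → (i ≡ᵇ j) ≡ true → i ≡ j
≡ᵇ⇒≡ {i = i} {j} e with i ≟ j
... | yes i≡j = i≡j

≢⇒≡ᵇ-false : ∀ {m} {i j : Fin m} → i ≢ j → (i ≡ᵇ j) ≡ false
≢⇒≡ᵇ-false {i = i} {j} = dec-false (i ≟ j)

any : ∀ {m} → (Fin m → Bool) → Bool
any {zero} f = false
any {suc m} f = f zero ∨ any (f ∘ suc)

any⁺ : ∀ {m} (f : Fin m → Bool) {i} → f i ≡ true → any f ≡ true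
any⁺ f {zero} e = ∨-true⁺ˡ e
any⁺ f {suc i} e = ∨-true⁺ʳ {f zero} (any⁺ (f ∘ suc) e)

any⁻ : ∀ {m} (f : Fin m → Bool) → any f ≡ true → ∃ λ i → f i ≡ true
any⁻ {suc m} f e with ∨-true⁻ {f zero} e
... | inj₁ e₀ = zero , e₀
... | inj₂ e₁ with any⁻ (f ∘ suc) e₁
... | i , eᵢ = suc i , eᵢ

any-false⁻ : ∀ {m} (f : Fin m → Bool) → any f ≡ false → ∀ i → f i ≡ false
any-false⁻ f e i with f i in eᵢ
... | true = ⊥-elim (true≢false (any⁺ f eᵢ) e)
... | false = refl

any-∨ : ∀ {m} (f g : Fin m → Bool) → any (λ i → f i ∨ g i) ≡ any f ∨ any g
any-∨ {zero} f g = refl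
any-∨ {suc m} f g =
  trans (cong ((f zero ∨ g zero) ∨_) (any-∨ (f ∘ suc) (g ∘ suc))) (∨-interchange (f zero) (g zero) _ _)

any-∧ʳ : ∀ {m} (f : Fin m → Bool) c → any (λ i → f i ∧ c) ≡ any f ∧ c
any-∧ʳ {zero} f c = refl
any-∧ʳ {suc m} f c = trans (cong ((f zero ∧ c) ∨_) (any-∧ʳ (f ∘ suc) c)) (sym (∧-distribʳ-∨ c (f zero) _))

any-∧ˡ : ∀ {m} c (f : Fin m → Bool) → any (λ i → c ∧ f i) ≡ c ∧ any f
any-∧ˡ {zero} c f = sym (∧-zeroʳ c)
any-∧ˡ {suc m} c f = trans (cong ((c ∧ f zero) ∨_) (any-∧ˡ c (f ∘ suc))) (sym (Bool.∧-distribˡ-∨ c (f zero) _))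

any-cong : ∀ {m} {f g : Fin m → Bool} → (∀ i → f i ≡ g i) → any f ≡ any g
any-cong {zero} _ = refl
any-cong {suc m} e = cong₂ _∨_ (e zero) (any-cong (e ∘ suc))

indicator : Bool → ℕ
indicator b = if b then 1 else 0

countTrue-cong : ∀ {m} {f g : Fin m → Bool} → (∀ i → f i ≡ g i) → countTrue f ≡ countTrue g
countTrue-cong {zero} _ = refl
countTrue-cong {suc m} e = cong₂ _+_ (cong indicator (e zero)) (countTrue-cong (e ∘ suc))

countTrue-≡0 : ∀ {m} {f : Fin m → Bool} → (∀ i → f i ≡ false) → countTrue f ≡ 0
countTrue-≡0 {zero} _ = refl
countTrue-≡0 {suc m} {f} e rewrite e zero = countTrue-≡0 {f = f ∘ suc} (e ∘ suc)

countTrue-+ : ∀ {m} (f g h : Fin m → Bool) →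
  (∀ i → indicator (f i) ≡ indicator (g i) + indicator (h i)) →
  countTrue f ≡ countTrue g + countTrue h
countTrue-+ {zero} _ _ _ _ = refl
countTrue-+ {suc m} f g h e =
  trans (cong₂ _+_ (e zero) (countTrue-+ (f ∘ suc) (g ∘ suc) (h ∘ suc) (e ∘ suc)))
        (interchange (indicator (g zero)) (indicator (h zero)) _ _)

countTrue-partition : ∀ {m} (f g : Fin m → Bool) →
  countTrue f ≡ countTrue (λ i → f i ∧ g i) + countTrue (λ i → f i ∧ not (g i))
countTrue-partition f g = countTrue-+ f _ _ (λ i → split (f i) (g i))
  where
    split : ∀ a b → indicator a ≡ indicator (a ∧ b) + indicator (a ∧ not b)
    split true true = refl
    split true false = refl
    split false _ = refl

countTrue-∨ : ∀ {m} (f g : Fin m → Bool) → countTrue (λ i → f i ∨ g i) ≤ countTrue f + countTrue g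
countTrue-∨ {zero} f g = z≤n
countTrue-∨ {suc m} f g = begin
  indicator (f zero ∨ g zero) + countTrue (λ i → f (suc i) ∨ g (suc i))
    ≤⟨ +-mono-≤ (∨-≤ (f zero) (g zero)) (countTrue-∨ (f ∘ suc) (g ∘ suc)) ⟩
  (indicator (f zero) + indicator (g zero)) + (countTrue (f ∘ suc) + countTrue (g ∘ suc))
    ≡⟨ interchange (indicator (f zero)) (indicator (g zero)) _ _ ⟩
  countTrue f + countTrue g ∎
  where
    open ≤-Reasoning
    ∨-≤ : ∀ a b → indicator (a ∨ b) ≤ indicator a + indicator b
    ∨-≤ true _ = s≤s z≤n
    ∨-≤ false _ = ≤-refl

countTrue-split : ∀ m n (f : Fin (m + n) → Bool) →
  countTrue f ≡ countTrue (λ i → f (i ↑ˡ n)) + countTrue (λ j → f (m ↑ʳ j))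
countTrue-split zero n f = refl
countTrue-split (suc m) n f =
  trans (cong (indicator (f zero) +_) (countTrue-split m n (f ∘ suc)))
        (sym (+-assoc (indicator (f zero)) _ _))

countTrue-remove : ∀ {m} (f : Fin m → Bool) {j} → f j ≡ true →
  countTrue f ≡ suc (countTrue (λ i → f i ∧ not (i ≡ᵇ j)))
countTrue-remove {suc m} f {zero} e rewrite e =
  cong suc (countTrue-cong (λ i → sym (∧-identityʳ (f (suc i)))))
countTrue-remove {suc m} f {suc j} e
  rewrite countTrue-remove (f ∘ suc) e | ∧-identityʳ (f zero) =
  +-suc (indicator (f zero)) _

countTrue-≤-injection : ∀ {a b} {P : Fin a → Bool} {Q : Fin b → Bool}
  (h : ∀ i → P i ≡ true → Fin b) →
  (∀ i p → Q (h i p) ≡ true) →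
  (∀ i j p q → h i p ≡ h j q → i ≡ j) →
  countTrue P ≤ countTrue Q
countTrue-≤-injection {zero} h into inj = z≤n
countTrue-≤-injection {suc a} {b} {P} {Q} h into inj with P zero in p₀
... | false = countTrue-≤-injection (h ∘ suc) (into ∘ suc)
                (λ i j p q e → suc-injective (inj (suc i) (suc j) p q e))
... | true = begin
    suc (countTrue (P ∘ suc))
      ≤⟨ s≤s (countTrue-≤-injection {Q = Q₋} (h ∘ suc) into₋
                (λ i j p q e → suc-injective (inj (suc i) (suc j) p q e))) ⟩
    suc (countTrue Q₋)
      ≡⟨ sym (countTrue-remove Q (into zero p₀)) ⟩
    countTrue Q ∎
  where
    open ≤-Reasoning
    Q₋ : Fin b → Bool
    Q₋ y = Q y ∧ not (y ≡ᵇ h zero p₀)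
    into₋ : ∀ i p → Q₋ (h (suc i) p) ≡ true
    into₋ i p = ∧-true⁺ (into (suc i) p)
      (cong not (≢⇒≡ᵇ-false (λ e → case inj (suc i) zero p p₀ e of λ ())))

countTrue-mono : ∀ {m} (f g : Fin m → Bool) → (∀ i → f i ≡ true → g i ≡ true) → countTrue f ≤ countTrue g
countTrue-mono f g f⊆g = countTrue-≤-injection (λ i _ → i) f⊆g (λ _ _ _ _ e → e)

countTrue-≥1 : ∀ {m} (f : Fin m → Bool) {i} → f i ≡ true → 1 ≤ countTrue f
countTrue-≥1 f e rewrite countTrue-remove f e = s≤s z≤n

countTrue-witness : ∀ {m} (f : Fin m → Bool) → 1 ≤ countTrue f → ∃ λ i → f i ≡ true
countTrue-witness {suc m} f 1≤ with f zero in e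
... | true = zero , e
... | false with countTrue-witness (f ∘ suc) 1≤
... | i , eᵢ = suc i , eᵢ

countTrue-singleton : ∀ {m} (j : Fin m) → countTrue (λ i → i ≡ᵇ j) ≡ 1
countTrue-singleton j =
  trans (countTrue-remove (λ i → i ≡ᵇ j) (≡ᵇ-refl j)) (cong suc (countTrue-≡0 (λ i → b∧¬b (i ≡ᵇ j))))
  where
    b∧¬b : ∀ b → b ∧ not b ≡ false
    b∧¬b true = refl
    b∧¬b false = refl

countTrue-≡-bijection : ∀ {a b} {P : Fin a → Bool} {Q : Fin b → Bool} (f : Fin a → Fin b) →
  (∀ i → P i ≡ true → Q (f i) ≡ true) →
  (∀ i j → P i ≡ true → P j ≡ true → f i ≡ f j → i ≡ j) →
  (∀ j → Q j ≡ true → ∃ λ i → P i ≡ true × f i ≡ j) →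
  countTrue P ≡ countTrue Q
countTrue-≡-bijection f into inj onto = ≤-antisym
  (countTrue-≤-injection (λ i _ → f i) into inj)
  (countTrue-≤-injection (λ j q → proj₁ (onto j q)) (λ j q → proj₁ (proj₂ (onto j q)))
     (λ j j′ q q′ e → trans (sym (proj₂ (proj₂ (onto j q)))) (trans (cong f e) (proj₂ (proj₂ (onto j′ q′))))))

firstTrue : ∀ {m} → ℕ → (Fin m → Bool) → Fin m → Bool
firstTrue k Q zero = Q zero ∧ (1 ≤ᵇ k)
firstTrue k Q (suc i) = firstTrue (k ∸ indicator (Q zero)) (Q ∘ suc) i

firstTrue-⊆ : ∀ {m} k (Q : Fin m → Bool) i → firstTrue k Q i ≡ true → Q i ≡ true
firstTrue-⊆ k Q zero e = ∧-true⁻ˡ e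
firstTrue-⊆ k Q (suc i) e = firstTrue-⊆ (k ∸ indicator (Q zero)) (Q ∘ suc) i e

countTrue-firstTrue : ∀ {m} k (Q : Fin m → Bool) → countTrue (firstTrue k Q) ≡ k ⊓ countTrue Q
countTrue-firstTrue {zero} k Q = sym (⊓-zeroʳ k)
countTrue-firstTrue {suc m} k Q with Q zero
... | false = countTrue-firstTrue k (Q ∘ suc)
countTrue-firstTrue {suc m} zero Q | true = countTrue-firstTrue 0 (Q ∘ suc)
countTrue-firstTrue {suc m} (suc k) Q | true = cong suc (countTrue-firstTrue k (Q ∘ suc))

module _ {A : Set} where

  pick : ∀ {m} → (Fin m → Bool) → (Fin m → A) → List A
  pick {zero} f t = []
  pick {suc m} f t with f zero
  ... | true = t zero ∷ pick (f ∘ suc) (t ∘ suc)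
  ... | false = pick (f ∘ suc) (t ∘ suc)

  pickIndex : ∀ {m} (f : Fin m → Bool) (t : Fin m → A) → Fin (length (pick f t)) → Fin m
  pickIndex {suc m} f t j with f zero
  pickIndex {suc m} f t zero | true = zero
  pickIndex {suc m} f t (suc j) | true = suc (pickIndex (f ∘ suc) (t ∘ suc) j)
  pickIndex {suc m} f t j | false = suc (pickIndex (f ∘ suc) (t ∘ suc) j)

  length-pick : ∀ {m} (f : Fin m → Bool) (t : Fin m → A) → length (pick f t) ≡ countTrue f
  length-pick {zero} f t = refl
  length-pick {suc m} f t with f zero
  ... | true = cong suc (length-pick (f ∘ suc) (t ∘ suc))
  ... | false = length-pick (f ∘ suc) (t ∘ suc)

  All-pick : ∀ {m} {Q : A → Set} (f : Fin m → Bool) (t : Fin m → A) → (∀ i → Q (t i)) → All Q (pick f t)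
  All-pick {zero} f t q = []
  All-pick {suc m} f t q with f zero
  ... | true = q zero ∷ All-pick (f ∘ suc) (t ∘ suc) (q ∘ suc)
  ... | false = All-pick (f ∘ suc) (t ∘ suc) (q ∘ suc)

  lookup-pick : ∀ {m} (f : Fin m → Bool) (t : Fin m → A) j → List.lookup (pick f t) j ≡ t (pickIndex f t j)
  lookup-pick {suc m} f t j with f zero
  lookup-pick {suc m} f t zero | true = refl
  lookup-pick {suc m} f t (suc j) | true = lookup-pick (f ∘ suc) (t ∘ suc) j
  lookup-pick {suc m} f t j | false = lookup-pick (f ∘ suc) (t ∘ suc) j

  pickIndex-picked : ∀ {m} (f : Fin m → Bool) (t : Fin m → A) j → f (pickIndex f t j) ≡ true
  pickIndex-picked {suc m} f t j with f zero in e
  pickIndex-picked {suc m} f t zero | true = e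
  pickIndex-picked {suc m} f t (suc j) | true = pickIndex-picked (f ∘ suc) (t ∘ suc) j
  pickIndex-picked {suc m} f t j | false = pickIndex-picked (f ∘ suc) (t ∘ suc) j

  pickIndex-injective : ∀ {m} (f : Fin m → Bool) (t : Fin m → A) i j → pickIndex f t i ≡ pickIndex f t j → i ≡ j
  pickIndex-injective {suc m} f t i j e with f zero
  pickIndex-injective {suc m} f t zero zero e | true = refl
  pickIndex-injective {suc m} f t (suc i) (suc j) e | true =
    cong suc (pickIndex-injective (f ∘ suc) (t ∘ suc) i j (suc-injective e))
  pickIndex-injective {suc m} f t i j e | false = pickIndex-injective (f ∘ suc) (t ∘ suc) i j (suc-injective e)

  pickIndex-surjective : ∀ {m} (f : Fin m → Bool) (t : Fin m → A) i → f i ≡ true → ∃ λ j → pickIndex f t j ≡ i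
  pickIndex-surjective {suc m} f t i e with f zero in e₀
  pickIndex-surjective {suc m} f t zero e | true = zero , refl
  pickIndex-surjective {suc m} f t (suc i) e | true =
    let (j , eⱼ) = pickIndex-surjective (f ∘ suc) (t ∘ suc) i e in suc j , cong suc eⱼ
  pickIndex-surjective {suc m} f t zero e | false = ⊥-elim (true≢false e e₀)
  pickIndex-surjective {suc m} f t (suc i) e | false =
    let (j , eⱼ) = pickIndex-surjective (f ∘ suc) (t ∘ suc) i e in j , cong suc eⱼ

allVecs : (k : ℕ) → List (Vec Bool k)
allVecs zero = [] ∷ []
allVecs (suc k) = List.map (true ∷_) (allVecs k) List.++ List.map (false ∷_) (allVecs k)

allVecs-complete : ∀ {k} (v : Vec Bool k) → v ∈ allVecs k
allVecs-complete [] = here refl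
allVecs-complete (true ∷ v) = ∈-++⁺ˡ (∈-map⁺ (true ∷_) (allVecs-complete v))
allVecs-complete {suc k} (false ∷ v) =
  ∈-++⁺ʳ (List.map (true ∷_) (allVecs k)) (∈-map⁺ (false ∷_) (allVecs-complete v))

listsUpTo : ∀ {A : Set} → ℕ → List A → List (List A)
listsUpTo zero xs = [] ∷ []
listsUpTo (suc b) xs = [] ∷ cartesianProductWith _∷_ xs (listsUpTo b xs)

listsUpTo-complete : ∀ {A : Set} b {xs ys : List A} → length ys ≤ b → All (_∈ xs) ys → ys ∈ listsUpTo b xs
listsUpTo-complete zero {ys = []} _ _ = here refl
listsUpTo-complete (suc b) {ys = []} _ _ = here refl
listsUpTo-complete (suc b) {ys = y ∷ ys} (s≤s len≤) (y∈ ∷ ys∈) =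
  there (∈-cartesianProductWith⁺ _∷_ y∈ (listsUpTo-complete b len≤ ys∈))

-- Hall's marriage theorem

module _ {k n : ℕ} where

  _⊆_ : (S L : Fin k → Bool) → Set
  S ⊆ L = ∀ i → S i ≡ true → L i ≡ true

  neighbours : (Fin k → Fin (suc n) → Bool) → (Fin k → Bool) → Fin (suc n) → Bool
  neighbours Adj S y = any (λ i → S i ∧ Adj i y)

  avoiding : (Fin k → Fin (suc n) → Bool) → (Fin (suc n) → Bool) → Fin k → Fin (suc n) → Bool
  avoiding Adj X i y = Adj i y ∧ not (X y)

  HallCondition : (Fin k → Fin (suc n) → Bool) → (Fin k → Bool) → Set
  HallCondition Adj L = ∀ S → S ⊆ L → countTrue S ≤ countTrue (neighbours Adj S)

  record Matching (Adj : Fin k → Fin (suc n) → Bool) (L : Fin k → Bool) : Set where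
    field
      match     : Fin k → Fin (suc n)
      adjacent  : ∀ i → L i ≡ true → Adj i (match i) ≡ true
      injective : ∀ i j → L i ≡ true → L j ≡ true → match i ≡ match j → i ≡ j
  open Matching public

  Tight : (Fin k → Fin (suc n) → Bool) → (Fin k → Bool) → (Fin k → Bool) → Set
  Tight Adj L S =
    S ⊆ L × 1 ≤ countTrue S × countTrue S < countTrue L × countTrue (neighbours Adj S) ≤ countTrue S

  tight? : ∀ Adj L S → Dec (Tight Adj L S)
  tight? Adj L S =
    all? (λ i → (S i Bool.≟ true) →-dec (L i Bool.≟ true)) ×-dec (1 ≤? countTrue S) ×-dec
    (countTrue S <? countTrue L) ×-dec (countTrue (neighbours Adj S) ≤? countTrue S)

  neighbours-cong : ∀ {Adj S S′} → (∀ i → S i ≡ S′ i) → ∀ y → neighbours Adj S y ≡ neighbours Adj S′ y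
  neighbours-cong {Adj} e y = any-cong (λ i → cong (_∧ Adj i y) (e i))

  Tight-cong : ∀ {Adj L S S′} → (∀ i → S i ≡ S′ i) → Tight Adj L S → Tight Adj L S′
  Tight-cong {Adj} {L} {S} {S′} e (S⊆L , 1≤S , S<L , N≤S) =
    (λ i → S⊆L i ∘ trans (e i)) ,
    subst (1 ≤_) |S|≡ 1≤S ,
    subst (_< _) |S|≡ S<L ,
    subst₂ _≤_ (countTrue-cong (neighbours-cong {Adj} e)) |S|≡ N≤S
    where
      |S|≡ : countTrue S ≡ countTrue S′
      |S|≡ = countTrue-cong e

  neighbours-avoiding : ∀ Adj X T y → neighbours (avoiding Adj X) T y ≡ neighbours Adj T y ∧ not (X y)
  neighbours-avoiding Adj X T y =
    trans (any-cong (λ i → sym (Bool.∧-assoc (T i) (Adj i y) (not (X y)))))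
          (any-∧ʳ (λ i → T i ∧ Adj i y) (not (X y)))

  neighbours-≤-avoiding : ∀ Adj X T →
    countTrue (neighbours Adj T) ≤ countTrue X + countTrue (neighbours (avoiding Adj X) T)
  neighbours-≤-avoiding Adj X T = begin
    countTrue (neighbours Adj T)
      ≡⟨ countTrue-partition (neighbours Adj T) X ⟩
    countTrue (λ y → neighbours Adj T y ∧ X y) + countTrue (λ y → neighbours Adj T y ∧ not (X y))
      ≤⟨ +-mono-≤ (countTrue-mono (λ y → neighbours Adj T y ∧ X y) X (λ y → ∧-true⁻ʳ {neighbours Adj T y}))
                  (≤-reflexive (countTrue-cong (λ y → sym (neighbours-avoiding Adj X T y)))) ⟩
    countTrue X + countTrue (neighbours (avoiding Adj X) T) ∎
    where open ≤-Reasoning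

  HallCondition-⊆ : ∀ {Adj L S} → HallCondition Adj L → S ⊆ L → HallCondition Adj S
  HallCondition-⊆ hc S⊆L T T⊆S = hc T (λ i → S⊆L i ∘ T⊆S i)

  countTrue-∖ : ∀ {S L} → S ⊆ L → countTrue L ≡ countTrue S + countTrue (λ i → L i ∧ not (S i))
  countTrue-∖ {S} {L} S⊆L =
    trans (countTrue-partition L S) (cong (_+ countTrue (λ i → L i ∧ not (S i))) (countTrue-cong L∧S≡S))
    where
      L∧S≡S : ∀ i → L i ∧ S i ≡ S i
      L∧S≡S i with S i in eᵢ
      ... | true = trans (∧-identityʳ (L i)) (S⊆L i eᵢ)
      ... | false = ∧-zeroʳ (L i)

  -- A tight set S uses up its neighbourhood, so the rest of L must find partners outside it.
  HallCondition-beyond-tight : ∀ {Adj L S} → HallCondition Adj L → S ⊆ L →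
    countTrue (neighbours Adj S) ≤ countTrue S →
    HallCondition (avoiding Adj (neighbours Adj S)) (λ i → L i ∧ not (S i))
  HallCondition-beyond-tight {Adj} {L} {S} hc S⊆L tight T T⊆L∖S = +-cancelˡ-≤ (countTrue S) _ _ (begin
    countTrue S + countTrue T                       ≡⟨ +-comm (countTrue S) _ ⟩
    countTrue T + countTrue S                       ≡⟨ countTrue-+ T∪S T S (λ i → disjoint (T i) (S i) (T⊆L∖S i)) ⟨
    countTrue T∪S                                   ≤⟨ hc T∪S T∪S⊆L ⟩
    countTrue (neighbours Adj T∪S)                  ≡⟨ countTrue-cong (λ y → any-∪ y) ⟩
    countTrue (λ y → NS y ∨ neighbours Adj T y)     ≤⟨ countTrue-+-≤ ⟩
    countTrue NS + countTrue N′T                    ≤⟨ +-monoˡ-≤ _ tight ⟩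
    countTrue S + countTrue N′T                     ∎)
    where
      open ≤-Reasoning
      NS N′T : Fin (suc n) → Bool
      NS = neighbours Adj S
      N′T = neighbours (avoiding Adj NS) T
      T∪S : Fin k → Bool
      T∪S i = T i ∨ S i
      T∪S⊆L : T∪S ⊆ L
      T∪S⊆L i e with ∨-true⁻ {T i} e
      ... | inj₁ Tᵢ = ∧-true⁻ˡ (T⊆L∖S i Tᵢ)
      ... | inj₂ Sᵢ = S⊆L i Sᵢ
      disjoint : ∀ {l} t s → (t ≡ true → l ∧ not s ≡ true) → indicator (t ∨ s) ≡ indicator t + indicator s
      disjoint {l} true true t→¬s = case ∧-true⁻ʳ {l} (t→¬s refl) of λ ()
      disjoint true false _ = refl
      disjoint false s _ = refl
      any-∪ : ∀ y → neighbours Adj T∪S y ≡ NS y ∨ neighbours Adj T y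
      any-∪ y = trans (any-cong (λ i → ∧-distribʳ-∨ (Adj i y) (T i) (S i)))
                      (trans (any-∨ (λ i → T i ∧ Adj i y) (λ i → S i ∧ Adj i y))
                             (Bool.∨-comm (neighbours Adj T y) (NS y)))
      countTrue-+-≤ : countTrue (λ y → NS y ∨ neighbours Adj T y) ≤ countTrue NS + countTrue N′T
      countTrue-+-≤ = ≤-reflexive (countTrue-+ _ NS N′T (λ y → trans (split (NS y) (neighbours Adj T y))
                        (cong (λ b → indicator (NS y) + indicator b) (sym (neighbours-avoiding Adj NS T y)))))
        where
          split : ∀ a b → indicator (a ∨ b) ≡ indicator a + indicator (b ∧ not a)
          split true b = cong suc (cong indicator (sym (∧-zeroʳ b)))
          split false b = cong indicator (sym (∧-identityʳ b))

  -- Without tight sets every nonempty proper T ⊆ L has a surplus neighbour, so deleting one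
  -- vertex from each side keeps Hall's condition.
  HallCondition-without-tight : ∀ {Adj L i₀} y₀ → HallCondition Adj L → (∀ S → ¬ Tight Adj L S) →
    L i₀ ≡ true → HallCondition (avoiding Adj (_≡ᵇ y₀)) (λ i → L i ∧ not (i ≡ᵇ i₀))
  HallCondition-without-tight {Adj} {L} {i₀} y₀ hc no-tight L₀ T T⊆L′ with countTrue T in |T|
  ... | zero = z≤n
  ... | suc t = +-cancelˡ-≤ 1 _ _ (begin
    suc (suc t)                                      ≡⟨ cong suc |T| ⟨
    suc (countTrue T)                                ≤⟨ surplus ⟩
    countTrue (neighbours Adj T)                     ≤⟨ neighbours-≤-avoiding Adj (_≡ᵇ y₀) T ⟩
    countTrue (_≡ᵇ y₀) + countTrue N′T               ≡⟨ cong (_+ countTrue N′T) (countTrue-singleton y₀) ⟩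
    suc (countTrue N′T)                              ∎)
    where
      open ≤-Reasoning
      N′T : Fin (suc n) → Bool
      N′T = neighbours (avoiding Adj (_≡ᵇ y₀)) T
      T⊆L : T ⊆ L
      T⊆L i = ∧-true⁻ˡ ∘ T⊆L′ i
      T<L : countTrue T < countTrue L
      T<L = subst (countTrue T <_) (sym (countTrue-remove L L₀)) (s≤s (countTrue-mono T _ T⊆L′))
      surplus : suc (countTrue T) ≤ countTrue (neighbours Adj T)
      surplus = ≰⇒> (λ N≤T → no-tight T (T⊆L , subst (1 ≤_) (sym |T|) (s≤s z≤n) , T<L , N≤T))

  matching-∅ : ∀ {Adj L} → countTrue L ≤ 0 → Matching Adj L
  matching-∅ {L = L} L≤0 = record
    { match = λ _ → zero
    ; adjacent = λ i Lᵢ → ⊥-elim (absurd Lᵢ)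
    ; injective = λ i j Lᵢ _ _ → ⊥-elim (absurd Lᵢ) }
    where
      absurd : ∀ {i} → L i ≡ true → ⊥
      absurd Lᵢ = case ≤-trans (countTrue-≥1 L Lᵢ) L≤0 of λ ()

  matching-merge : ∀ {Adj L} S X → (m₁ : Matching Adj S) → (∀ i → S i ≡ true → X (match m₁ i) ≡ true) →
    Matching (avoiding Adj X) (λ i → L i ∧ not (S i)) → Matching Adj L
  matching-merge {Adj} {L} S X m₁ m₁∈X m₂ = record
    { match = merged ; adjacent = merged-adjacent ; injective = merged-injective }
    where
      merged : Fin k → Fin (suc n)
      merged i = if S i then match m₁ i else match m₂ i
      cover : ∀ i → L i ≡ true → S i ≡ false → L i ∧ not (S i) ≡ true
      cover i Lᵢ Sᵢ = ∧-true⁺ Lᵢ (cong not Sᵢ)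
      m₂∉X : ∀ i → L i ∧ not (S i) ≡ true → X (match m₂ i) ≡ false
      m₂∉X i Rᵢ = not-true⁻ (∧-true⁻ʳ {Adj i (match m₂ i)} (adjacent m₂ i Rᵢ))
      merged-adjacent : ∀ i → L i ≡ true → Adj i (merged i) ≡ true
      merged-adjacent i Lᵢ with S i in Sᵢ
      ... | true = adjacent m₁ i Sᵢ
      ... | false = ∧-true⁻ˡ (adjacent m₂ i (cover i Lᵢ Sᵢ))
      merged-injective : ∀ i j → L i ≡ true → L j ≡ true → merged i ≡ merged j → i ≡ j
      merged-injective i j Lᵢ Lⱼ e with S i in Sᵢ | S j in Sⱼ
      ... | true | true = injective m₁ i j Sᵢ Sⱼ e
      ... | false | false = injective m₂ i j (cover i Lᵢ Sᵢ) (cover j Lⱼ Sⱼ) e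
      ... | true | false = ⊥-elim (true≢false (trans (cong X (sym e)) (m₁∈X i Sᵢ)) (m₂∉X j (cover j Lⱼ Sⱼ)))
      ... | false | true = ⊥-elim (true≢false (trans (cong X e) (m₁∈X j Sⱼ)) (m₂∉X i (cover i Lᵢ Sᵢ)))

  Matcher : ℕ → Set
  Matcher c = ∀ Adj {L} → countTrue L ≤ c → HallCondition Adj L → Matching Adj L

  matching-via-tight : ∀ {c Adj L S} → Matcher c → countTrue L ≤ suc c → HallCondition Adj L →
    Tight Adj L S → Matching Adj L
  matching-via-tight {c} {Adj} {L} {S} hall-c L≤c hc (S⊆L , 1≤S , S<L , N≤S) =
    matching-merge S (neighbours Adj S) m₁ m₁∈N m₂
    where
      m₁ : Matching Adj S
      m₁ = hall-c Adj (s≤s⁻¹ (≤-trans S<L L≤c)) (HallCondition-⊆ {Adj} hc S⊆L)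
      m₁∈N : ∀ i → S i ≡ true → neighbours Adj S (match m₁ i) ≡ true
      m₁∈N i Sᵢ = any⁺ (λ j → S j ∧ Adj j (match m₁ i)) (∧-true⁺ Sᵢ (adjacent m₁ i Sᵢ))
      L∖S≤c : countTrue (λ i → L i ∧ not (S i)) ≤ c
      L∖S≤c = s≤s⁻¹ (≤-trans (+-monoˡ-≤ _ 1≤S) (subst (_≤ suc c) (countTrue-∖ S⊆L) L≤c))
      m₂ : Matching (avoiding Adj (neighbours Adj S)) (λ i → L i ∧ not (S i))
      m₂ = hall-c _ L∖S≤c (HallCondition-beyond-tight {Adj} hc S⊆L N≤S)

  neighbour-exists : ∀ {Adj L i₀} → HallCondition Adj L → L i₀ ≡ true → ∃ λ y → Adj i₀ y ≡ true
  neighbour-exists {Adj} {L} {i₀} hc L₀ with countTrue-witness (neighbours Adj (_≡ᵇ i₀))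
    (subst (_≤ countTrue (neighbours Adj (_≡ᵇ i₀))) (countTrue-singleton i₀)
           (hc (_≡ᵇ i₀) (λ i e → subst (λ j → L j ≡ true) (sym (≡ᵇ⇒≡ e)) L₀)))
  ... | y , e with any⁻ (λ i → (i ≡ᵇ i₀) ∧ Adj i y) e
  ...   | i , eᵢ = y , subst (λ j → Adj j y ≡ true) (≡ᵇ⇒≡ (∧-true⁻ˡ eᵢ)) (∧-true⁻ʳ {i ≡ᵇ i₀} eᵢ)

  matching-singleton : ∀ {Adj i₀ y₀} → Adj i₀ y₀ ≡ true → Matching Adj (_≡ᵇ i₀)
  matching-singleton {Adj} {i₀} {y₀} adj = record
    { match = λ _ → y₀
    ; adjacent = λ i e → subst (λ j → Adj j y₀ ≡ true) (sym (≡ᵇ⇒≡ e)) adj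
    ; injective = λ i j eᵢ eⱼ _ → trans (≡ᵇ⇒≡ eᵢ) (sym (≡ᵇ⇒≡ eⱼ)) }

  matching-without-tight : ∀ {c Adj L i₀} → Matcher c → countTrue L ≤ suc c → HallCondition Adj L →
    (∀ S → ¬ Tight Adj L S) → L i₀ ≡ true → Matching Adj L
  matching-without-tight {c} {Adj} {L} {i₀} hall-c L≤c hc no-tight L₀ =
    matching-merge (_≡ᵇ i₀) (_≡ᵇ y₀) (matching-singleton adj₀) (λ _ _ → ≡ᵇ-refl y₀)
      (hall-c _ L′≤c (HallCondition-without-tight {Adj} y₀ hc no-tight L₀))
    where
      y₀ : Fin (suc n)
      y₀ = proj₁ (neighbour-exists {Adj} hc L₀)
      adj₀ : Adj i₀ y₀ ≡ true
      adj₀ = proj₂ (neighbour-exists {Adj} hc L₀)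
      L′≤c : countTrue (λ i → L i ∧ not (i ≡ᵇ i₀)) ≤ c
      L′≤c = s≤s⁻¹ (subst (_≤ suc c) (countTrue-remove L L₀) L≤c)

  hall : ∀ c → Matcher c
  hall zero Adj L≤0 _ = matching-∅ {Adj} L≤0
  hall (suc c) Adj {L} L≤c hc with anySubset? (tight? Adj L ∘ lookup) | any L in nonempty
  ... | yes (S , tight) | _ = matching-via-tight (hall c) L≤c hc tight
  ... | no _ | false = matching-∅ {Adj} (≤-reflexive (countTrue-≡0 (any-false⁻ L nonempty)))
  ... | no no-tight | true = matching-without-tight {Adj = Adj} (hall c) L≤c hc
          (λ S tight → no-tight (tabulate S , Tight-cong {Adj} (sym ∘ lookup∘tabulate S) tight))
          (proj₂ (any⁻ L nonempty))

-- Models and locally injective homomorphisms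

module _ {P : ℕ} where

  sumWith : (A C : Model P) → (World A → World C → Bool) → Model P
  sumWith A C cross = record
    { size = size A + suc (size C)
    ; R = λ x y → R⊎ (splitAt (suc (size A)) x) (splitAt (suc (size A)) y)
    ; V = λ p x → [ V A p , V C p ]′ (splitAt (suc (size A)) x) }
    where
      R⊎ : World A ⊎ World C → World A ⊎ World C → Bool
      R⊎ (inj₁ x) (inj₁ y) = R A x y
      R⊎ (inj₁ x) (inj₂ z) = cross x z
      R⊎ (inj₂ z) (inj₁ y) = false
      R⊎ (inj₂ z) (inj₂ z′) = R C z z′

  module Sum (A C : Model P) (cross : World A → World C → Bool) where

    X : Model P
    X = sumWith A C cross

    inl : World A → World X
    inl x = x ↑ˡ suc (size C)

    inr : World C → World X
    inr z = suc (size A) ↑ʳ z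

    split : World X → World A ⊎ World C
    split = splitAt (suc (size A))

    split-inl : ∀ x → split (inl x) ≡ inj₁ x
    split-inl x = splitAt-↑ˡ (suc (size A)) x (suc (size C))

    split-inr : ∀ z → split (inr z) ≡ inj₂ z
    split-inr = splitAt-↑ʳ (suc (size A)) (suc (size C))

    data Side : World X → Set where
      left  : ∀ x → Side (inl x)
      right : ∀ z → Side (inr z)

    side : ∀ w → Side w
    side w with split w in e
    ... | inj₁ x = subst Side (splitAt⁻¹-↑ˡ e) (left x)
    ... | inj₂ z = subst Side (splitAt⁻¹-↑ʳ e) (right z)

    inl-injective : ∀ {x y} → inl x ≡ inl y → x ≡ y
    inl-injective = ↑ˡ-injective (suc (size C)) _ _

    either : ∀ {B : Set} → (World A → B) → (World C → B) → World X → B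
    either f g w = [ f , g ]′ (split w)

    either-inl : ∀ {B : Set} (f : World A → B) (g : World C → B) x → either f g (inl x) ≡ f x
    either-inl f g x = cong [ f , g ]′ (split-inl x)

    either-inr : ∀ {B : Set} (f : World A → B) (g : World C → B) z → either f g (inr z) ≡ g z
    either-inr f g z = cong [ f , g ]′ (split-inr z)

    R-inl-inl : ∀ x y → R X (inl x) (inl y) ≡ R A x y
    R-inl-inl x y rewrite split-inl x | split-inl y = refl

    R-inl-inr : ∀ x z → R X (inl x) (inr z) ≡ cross x z
    R-inl-inr x z rewrite split-inl x | split-inr z = refl

    R-inr-inl : ∀ z y → R X (inr z) (inl y) ≡ false
    R-inr-inl z y rewrite split-inr z | split-inl y = refl

    R-inr-inr : ∀ z z′ → R X (inr z) (inr z′) ≡ R C z z′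
    R-inr-inr z z′ rewrite split-inr z | split-inr z′ = refl

    R-inl-inl⁻ : ∀ {x y} → R X (inl x) (inl y) ≡ true → R A x y ≡ true
    R-inl-inl⁻ {x} {y} = trans (sym (R-inl-inl x y))

    R-inl-inr⁻ : ∀ {x z} → R X (inl x) (inr z) ≡ true → cross x z ≡ true
    R-inl-inr⁻ {x} {z} = trans (sym (R-inl-inr x z))

    R-inr-inl⁻ : ∀ {z y} → R X (inr z) (inl y) ≡ true → ⊥
    R-inr-inl⁻ {z} {y} e = true≢false e (R-inr-inl z y)

    R-inr-inr⁻ : ∀ {z z′} → R X (inr z) (inr z′) ≡ true → R C z z′ ≡ true
    R-inr-inr⁻ {z} {z′} = trans (sym (R-inr-inr z z′))

    V-inl : ∀ p x → V X p (inl x) ≡ V A p x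
    V-inl p = either-inl (V A p) (V C p)

    V-inr : ∀ p z → V X p (inr z) ≡ V C p z
    V-inr p = either-inr (V A p) (V C p)

    successors-inl : ∀ x (s : World X → Bool) → countTrue (λ w → R X (inl x) w ∧ s w) ≡
      countTrue (λ y → R A x y ∧ s (inl y)) + countTrue (λ z → cross x z ∧ s (inr z))
    successors-inl x s =
      trans (countTrue-split (suc (size A)) (suc (size C)) (λ w → R X (inl x) w ∧ s w)) (cong₂ _+_
      (countTrue-cong (λ y → cong (_∧ s (inl y)) (R-inl-inl x y)))
      (countTrue-cong (λ z → cong (_∧ s (inr z)) (R-inl-inr x z))))

    successors-inr : ∀ z (s : World X → Bool) →
      countTrue (λ w → R X (inr z) w ∧ s w) ≡ countTrue (λ z′ → R C z z′ ∧ s (inr z′))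
    successors-inr z s =
      trans (countTrue-split (suc (size A)) (suc (size C)) (λ w → R X (inr z) w ∧ s w)) (cong₂ _+_
      (countTrue-≡0 (λ y → cong (_∧ s (inl y)) (R-inr-inl z y)))
      (countTrue-cong (λ z′ → cong (_∧ s (inr z′)) (R-inr-inr z z′))))

    sat-inr : ∀ χ z → sat X χ (inr z) ≡ sat C χ z
    sat-inr (atom p) z = V-inr p z
    sat-inr (neg χ) z = cong not (sat-inr χ z)
    sat-inr (conj χ ψ) z = cong₂ _∧_ (sat-inr χ z) (sat-inr ψ z)
    sat-inr (disj χ ψ) z = cong₂ _∨_ (sat-inr χ z) (sat-inr ψ z)
    sat-inr (dia k _ χ) z = cong (k ≤ᵇ_) (trans (successors-inr z (sat X χ))
      (countTrue-cong (λ z′ → cong (R C z z′ ∧_) (sat-inr χ z′))))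

  record LocallyInjectiveHom (M N : Model P) : Set where
    field
      map               : World M → World N
      preserves-V       : ∀ p x → V M p x ≡ V N p (map x)
      preserves-R       : ∀ x y → R M x y ≡ true → R N (map x) (map y) ≡ true
      locally-injective : ∀ x y y′ → R M x y ≡ true → R M x y′ ≡ true → map y ≡ map y′ → y ≡ y′
  open LocallyInjectiveHom public

  record LocallyBijectiveHom (M N : Model P) : Set where
    field
      hom                : LocallyInjectiveHom M N
      locally-surjective : ∀ x z → R N (map hom x) z ≡ true → ∃ λ y → R M x y ≡ true × map hom y ≡ z
  open LocallyBijectiveHom public

  embedding⇒hom : ∀ {M N w v} → Embedding M w N v → LocallyInjectiveHom M N
  embedding⇒hom e = record
    { map = f
    ; preserves-V = f-V
    ; preserves-R = λ x y → trans (sym (f-R x y))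
    ; locally-injective = λ _ _ _ _ _ → f-inj }
    where open Embedding e

  existential-preserved : ∀ {M N} (h : LocallyInjectiveHom M N) {ψ} → Existential ψ →
    ∀ x → M ⊨ ψ at x → N ⊨ ψ at map h x
  existential-preserved h (ex-atom p) x e = trans (sym (preserves-V h p x)) e
  existential-preserved h (ex-neg p) x e = trans (cong not (sym (preserves-V h p x))) e
  existential-preserved {M} h (ex-conj {φ} ex-φ ex-ψ) x e =
    ∧-true⁺ (existential-preserved h ex-φ x (∧-true⁻ˡ e)) (existential-preserved h ex-ψ x (∧-true⁻ʳ {sat M φ x} e))
  existential-preserved {M} {N} h (ex-disj {φ} ex-φ ex-ψ) x e with ∨-true⁻ {sat M φ x} e
  ... | inj₁ eφ = ∨-true⁺ˡ (existential-preserved h ex-φ x eφ)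
  ... | inj₂ eψ = ∨-true⁺ʳ {sat N φ (map h x)} (existential-preserved h ex-ψ x eψ)
  existential-preserved {M} {N} h (ex-dia {k} _ {φ} ex-φ) x e = ≤ᵇ-true⁺ (≤-trans (≤ᵇ-true⁻ {k} e)
    (countTrue-≤-injection {Q = λ z → R N (map h x) z ∧ sat N φ z} (λ y _ → map h y)
      (λ y e′ → ∧-true⁺ (preserves-R h x y (∧-true⁻ˡ e′)) (existential-preserved h ex-φ y (∧-true⁻ʳ {R M x y} e′)))
      (λ y y′ e′ e″ → locally-injective h x y y′ (∧-true⁻ˡ e′) (∧-true⁻ˡ e″))))

  sat-locally-bijective : ∀ {M N} (f : LocallyBijectiveHom M N) χ x → sat M χ x ≡ sat N χ (map (hom f) x)
  sat-locally-bijective f (atom p) x = preserves-V (hom f) p x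
  sat-locally-bijective f (neg χ) x = cong not (sat-locally-bijective f χ x)
  sat-locally-bijective f (conj χ ψ) x = cong₂ _∧_ (sat-locally-bijective f χ x) (sat-locally-bijective f ψ x)
  sat-locally-bijective f (disj χ ψ) x = cong₂ _∨_ (sat-locally-bijective f χ x) (sat-locally-bijective f ψ x)
  sat-locally-bijective {M} {N} f (dia k _ χ) x = cong (k ≤ᵇ_) (trans
    (countTrue-cong (λ y → cong (R M x y ∧_) (sat-locally-bijective f χ y)))
    (countTrue-≡-bijection g
      (λ y e → ∧-true⁺ (preserves-R h x y (∧-true⁻ˡ e)) (∧-true⁻ʳ {R M x y} e))
      (λ y y′ e e′ → locally-injective h x y y′ (∧-true⁻ˡ e) (∧-true⁻ˡ e′))
      onto))
    where
      h : LocallyInjectiveHom M N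
      h = hom f
      g : World M → World N
      g = map h
      onto : ∀ z → R N (g x) z ∧ sat N χ z ≡ true → ∃ λ y → R M x y ∧ sat N χ (g y) ≡ true × g y ≡ z
      onto z e with locally-surjective f x z (∧-true⁻ˡ e)
      ... | y , Rxy , refl = y , ∧-true⁺ Rxy (∧-true⁻ʳ {R N (g x) (g y)} e) , refl

  -- Glue T onto N so that each x sees, besides its own successors, every successor of h x that
  -- h misses; the glued model then collapses onto N without changing any counts.
  module Glue {T N : Model P} (h : LocallyInjectiveHom T N) where

    hit : World T → World N → Bool
    hit x z = any (λ y → R T x y ∧ (map h y ≡ᵇ z))

    cross : World T → World N → Bool
    cross x z = R N (map h x) z ∧ not (hit x z)

    open Sum T N cross public

    cross-misses-hits : ∀ {x y z} → R T x y ≡ true → cross x z ≡ true → map h y ≢ z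
    cross-misses-hits {x} {y} {z} Rxy cxz refl =
      true≢false (any⁺ (λ y′ → R T x y′ ∧ (map h y′ ≡ᵇ z)) (∧-true⁺ Rxy (≡ᵇ-refl z)))
                 (not-true⁻ (∧-true⁻ʳ {R N (map h x) z} cxz))

    squash : World X → World N
    squash = either (map h) (λ z → z)

    squash-inl : ∀ x → squash (inl x) ≡ map h x
    squash-inl = either-inl (map h) (λ z → z)

    squash-inr : ∀ z → squash (inr z) ≡ z
    squash-inr = either-inr (map h) (λ z → z)

    squash-V : ∀ p w → V X p w ≡ V N p (squash w)
    squash-V p w with side w
    ... | left x rewrite squash-inl x = trans (V-inl p x) (preserves-V h p x)
    ... | right z rewrite squash-inr z = V-inr p z

    squash-R : ∀ w u → R X w u ≡ true → R N (squash w) (squash u) ≡ true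
    squash-R w u e with side w | side u
    ... | left x | left y rewrite squash-inl x | squash-inl y = preserves-R h x y (R-inl-inl⁻ {x} {y} e)
    ... | left x | right z rewrite squash-inl x | squash-inr z = ∧-true⁻ˡ (R-inl-inr⁻ {x} {z} e)
    ... | right z | left y = ⊥-elim (R-inr-inl⁻ {z} {y} e)
    ... | right z | right z′ rewrite squash-inr z | squash-inr z′ = R-inr-inr⁻ {z} {z′} e

    squash-injective : ∀ w u u′ → R X w u ≡ true → R X w u′ ≡ true → squash u ≡ squash u′ → u ≡ u′
    squash-injective w u u′ e e′ eq with side w | side u | side u′
    ... | left x | left y | left y′ =
      cong inl (locally-injective h x y y′ (R-inl-inl⁻ {x} {y} e) (R-inl-inl⁻ {x} {y′} e′)
                                          (trans (sym (squash-inl y)) (trans eq (squash-inl y′))))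
    ... | left x | left y | right z = ⊥-elim (cross-misses-hits (R-inl-inl⁻ {x} {y} e) (R-inl-inr⁻ {x} {z} e′)
                                          (trans (sym (squash-inl y)) (trans eq (squash-inr z))))
    ... | left x | right z | left y = ⊥-elim (cross-misses-hits (R-inl-inl⁻ {x} {y} e′) (R-inl-inr⁻ {x} {z} e)
                                          (trans (sym (squash-inl y)) (trans (sym eq) (squash-inr z))))
    ... | left _ | right z | right z′ = cong inr (trans (sym (squash-inr z)) (trans eq (squash-inr z′)))
    ... | right z | left y | _ = ⊥-elim (R-inr-inl⁻ {z} {y} e)
    ... | right z | right _ | left y = ⊥-elim (R-inr-inl⁻ {z} {y} e′)
    ... | right _ | right z | right z′ = cong inr (trans (sym (squash-inr z)) (trans eq (squash-inr z′)))

    squash-surjective : ∀ w z → R N (squash w) z ≡ true → ∃ λ u → R X w u ≡ true × squash u ≡ z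
    squash-surjective w z e with side w
    ... | right z₀ = inr z , trans (R-inr-inr z₀ z) (subst (λ a → R N a z ≡ true) (squash-inr z₀) e) , squash-inr z
    ... | left x with hit x z in hx
    ...   | true = let (y , e′) = any⁻ (λ y → R T x y ∧ (map h y ≡ᵇ z)) hx in
                   inl y , trans (R-inl-inl x y) (∧-true⁻ˡ e′) , trans (squash-inl y) (≡ᵇ⇒≡ (∧-true⁻ʳ {R T x y} e′))
    ...   | false =
      inr z , trans (R-inl-inr x z) (∧-true⁺ (subst (λ a → R N a z ≡ true) (squash-inl x) e) (cong not hx)) , squash-inr z

    collapse : LocallyBijectiveHom X N
    collapse = record
      { hom = record
          { map = squash ; preserves-V = squash-V ; preserves-R = squash-R ; locally-injective = squash-injective }
      ; locally-surjective = squash-surjective }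

    embedding : ∀ x → Embedding T x X (inl x)
    embedding x = record
      { f = inl ; f-inj = inl-injective ; f-point = refl
      ; f-R = λ u z → sym (R-inl-inl u z) ; f-V = λ p u → sym (V-inl p u) }

  preserved-along-hom : ∀ {φ T N} → PreservedUnderEmbeddings φ → (h : LocallyInjectiveHom T N) →
    ∀ x → T ⊨ φ at x → N ⊨ φ at map h x
  preserved-along-hom {φ} {T} {N} preserved h x Tφ = begin
    sat N φ (map h x)          ≡⟨ cong (sat N φ) (squash-inl x) ⟨
    sat N φ (squash (inl x))   ≡⟨ sat-locally-bijective collapse φ (inl x) ⟨
    sat X φ (inl x)            ≡⟨ preserved T x X (inl x) (embedding x) Tφ ⟩
    true                       ∎
    where
      open Glue h
      open ≡-Reasoning

existential-equivalent⇒preserved : ∀ {P} {φ ψ : GML P} → Existential ψ → Equivalent φ ψ → PreservedUnderEmbeddings φ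
existential-equivalent⇒preserved {φ = φ} {ψ} ψ-existential φ≡ψ M w N v e Mφ =
  trans (φ≡ψ N v) (subst (λ u → N ⊨ ψ at u) (Embedding.f-point e)
    (existential-preserved (embedding⇒hom e) ψ-existential w (trans (sym (φ≡ψ M w)) Mφ)))

attach : ∀ {P} → Model P → Model P → Model P
attach A C = sumWith A C (λ x z → (x ≡ᵇ zero) ∧ (z ≡ᵇ zero))

module Attach {P} (A C : Model P) (root-fresh : ∀ y → R A y zero ≡ false) where
  open Sum A C (λ x z → (x ≡ᵇ zero) ∧ (z ≡ᵇ zero)) public

  attach-root-fresh : ∀ w → R X w zero ≡ false
  attach-root-fresh w with side w
  ... | left y = trans (R-inl-inl y zero) (root-fresh y)
  ... | right z = R-inr-inl z zero

  mutual
    sat-inl-suc : ∀ χ x → sat X χ (inl (suc x)) ≡ sat A χ (suc x)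
    sat-inl-suc (atom p) x = V-inl p (suc x)
    sat-inl-suc (neg χ) x = cong not (sat-inl-suc χ x)
    sat-inl-suc (conj χ ψ) x = cong₂ _∧_ (sat-inl-suc χ x) (sat-inl-suc ψ x)
    sat-inl-suc (disj χ ψ) x = cong₂ _∨_ (sat-inl-suc χ x) (sat-inl-suc ψ x)
    sat-inl-suc (dia k _ χ) x = cong (k ≤ᵇ_) (begin
      countTrue (λ w → R X (inl (suc x)) w ∧ sat X χ w)
        ≡⟨ successors-inl (suc x) (sat X χ) ⟩
      countTrue (λ y → R A (suc x) y ∧ sat X χ (inl y)) + countTrue {suc (size C)} (λ _ → false)
        ≡⟨ cong₂ _+_ (countTrue-cong (sat-inl-successor χ (suc x))) (countTrue-≡0 {suc (size C)} (λ _ → refl)) ⟩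
      countTrue (λ y → R A (suc x) y ∧ sat A χ y) + 0
        ≡⟨ +-identityʳ _ ⟩
      countTrue (λ y → R A (suc x) y ∧ sat A χ y) ∎)
      where open ≡-Reasoning

    sat-inl-successor : ∀ χ x y → (R A x y ∧ sat X χ (inl y)) ≡ (R A x y ∧ sat A χ y)
    sat-inl-successor χ x zero rewrite root-fresh x = refl
    sat-inl-successor χ x (suc y) = cong (R A x (suc y) ∧_) (sat-inl-suc χ y)

  root-count : ∀ χ → countTrue (λ w → R X zero w ∧ sat X χ w) ≡
    countTrue (λ y → R A zero y ∧ sat A χ y) + indicator (sat C χ zero)
  root-count χ = trans (successors-inl zero (sat X χ)) (cong₂ _+_
    (countTrue-cong (sat-inl-successor χ zero))
    (trans (cong₂ _+_ (cong indicator (sat-inr χ zero)) (countTrue-≡0 {size C} (λ _ → refl)))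
           (+-identityʳ _)))

  root-successor : ∀ w → R X zero w ≡ true → (∃ λ y → R A zero y ≡ true × w ≡ inl y) ⊎ w ≡ inr zero
  root-successor w e with side w
  ... | left y = inj₁ (y , R-inl-inl⁻ {zero} {y} e , refl)
  ... | right z = inj₂ (cong inr (≡ᵇ⇒≡ (R-inl-inr⁻ {zero} {z} e)))

  cross⇒roots : ∀ {x z} → R X (inl x) (inr z) ≡ true → x ≡ zero × z ≡ zero
  cross⇒roots {x} {z} e =
    ≡ᵇ⇒≡ (∧-true⁻ˡ (R-inl-inr⁻ {x} {z} e)) , ≡ᵇ⇒≡ (∧-true⁻ʳ {x ≡ᵇ zero} (R-inl-inr⁻ {x} {z} e))

  attach-hom : ∀ {N} (hA : LocallyInjectiveHom A N) (hC : LocallyInjectiveHom C N) →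
    R N (map hA zero) (map hC zero) ≡ true →
    (∀ y → R A zero y ≡ true → map hA y ≢ map hC zero) →
    LocallyInjectiveHom X N
  attach-hom {N} hA hC root-edge fresh = record
    { map = g ; preserves-V = g-V ; preserves-R = g-R ; locally-injective = g-injective }
    where
      g : World X → World N
      g = either (map hA) (map hC)
      g-inl : ∀ x → g (inl x) ≡ map hA x
      g-inl = either-inl (map hA) (map hC)
      g-inr : ∀ z → g (inr z) ≡ map hC z
      g-inr = either-inr (map hA) (map hC)
      g-V : ∀ p w → V X p w ≡ V N p (g w)
      g-V p w with side w
      ... | left x rewrite g-inl x = trans (V-inl p x) (preserves-V hA p x)
      ... | right z rewrite g-inr z = trans (V-inr p z) (preserves-V hC p z)
      g-R : ∀ w u → R X w u ≡ true → R N (g w) (g u) ≡ true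
      g-R w u e with side w | side u
      ... | left x | left y rewrite g-inl x | g-inl y = preserves-R hA x y (R-inl-inl⁻ {x} {y} e)
      ... | left x | right z with cross⇒roots {x} {z} e
      ...   | refl , refl rewrite g-inl zero | g-inr zero = root-edge
      g-R w u e | right z | left y = ⊥-elim (R-inr-inl⁻ {z} {y} e)
      g-R w u e | right z | right z′ rewrite g-inr z | g-inr z′ = preserves-R hC z z′ (R-inr-inr⁻ {z} {z′} e)
      clash : ∀ {x y z} → R X (inl x) (inl y) ≡ true → R X (inl x) (inr z) ≡ true → g (inl y) ≢ g (inr z)
      clash {x} {y} {z} e e′ eq with cross⇒roots {x} {z} e′
      ... | refl , refl = fresh y (R-inl-inl⁻ {zero} {y} e) (trans (sym (g-inl y)) (trans eq (g-inr zero)))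
      g-injective : ∀ w u u′ → R X w u ≡ true → R X w u′ ≡ true → g u ≡ g u′ → u ≡ u′
      g-injective w u u′ e e′ eq with side w | side u | side u′
      ... | left x | left y | left y′ =
        cong inl (locally-injective hA x y y′ (R-inl-inl⁻ {x} {y} e) (R-inl-inl⁻ {x} {y′} e′)
                                            (trans (sym (g-inl y)) (trans eq (g-inl y′))))
      ... | left x | left y | right z = ⊥-elim (clash {x} {y} {z} e e′ eq)
      ... | left x | right z | left y = ⊥-elim (clash {x} {y} {z} e′ e (sym eq))
      ... | left x | right z | right z′ =
        cong inr (trans (proj₂ (cross⇒roots {x} {z} e)) (sym (proj₂ (cross⇒roots {x} {z′} e′))))
      ... | right z | left y | _ = ⊥-elim (R-inr-inl⁻ {z} {y} e)
      ... | right z | right _ | left y = ⊥-elim (R-inr-inl⁻ {z} {y} e′)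
      ... | right z | right z′ | right z″ =
        cong inr (locally-injective hC z z′ z″ (R-inr-inr⁻ {z} {z′} e) (R-inr-inr⁻ {z} {z″} e′)
                                              (trans (sym (g-inr z′)) (trans eq (g-inr z″))))

-- GML has no constants; ⊤ᶠ and ⊥ᶠ are built from an arbitrary atom p₀.
module Connectives {P : ℕ} (p₀ : Fin P) where

  ⊤ᶠ ⊥ᶠ : GML P
  ⊤ᶠ = disj (atom p₀) (neg (atom p₀))
  ⊥ᶠ = conj (atom p₀) (neg (atom p₀))

  sat-⊤ᶠ : ∀ M w → M ⊨ ⊤ᶠ at w
  sat-⊤ᶠ M w = Bool.∨-inverseʳ (V M p₀ w)

  sat-⊥ᶠ : ∀ M w → sat M ⊥ᶠ w ≡ false
  sat-⊥ᶠ M w = Bool.∧-inverseʳ (V M p₀ w)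

  ⋀ ⋁ : List (GML P) → GML P
  ⋀ [] = ⊤ᶠ
  ⋀ (φ ∷ φs) = conj φ (⋀ φs)
  ⋁ [] = ⊥ᶠ
  ⋁ (φ ∷ φs) = disj φ (⋁ φs)

  module _ (M : Model P) (w : World M) where

    ⋀-sat⁺ : ∀ {φs} → All (λ φ → M ⊨ φ at w) φs → M ⊨ ⋀ φs at w
    ⋀-sat⁺ [] = sat-⊤ᶠ M w
    ⋀-sat⁺ (e ∷ es) = ∧-true⁺ e (⋀-sat⁺ es)

    ⋀-sat⁻ : ∀ φs → M ⊨ ⋀ φs at w → All (λ φ → M ⊨ φ at w) φs
    ⋀-sat⁻ [] _ = []
    ⋀-sat⁻ (φ ∷ φs) e = ∧-true⁻ˡ e ∷ ⋀-sat⁻ φs (∧-true⁻ʳ {sat M φ w} e)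

    ⋁-sat⁺ : ∀ {φs} → Any (λ φ → M ⊨ φ at w) φs → M ⊨ ⋁ φs at w
    ⋁-sat⁺ (here e) = ∨-true⁺ˡ e
    ⋁-sat⁺ {φ ∷ _} (there e) = ∨-true⁺ʳ {sat M φ w} (⋁-sat⁺ e)

    ⋁-sat⁻ : ∀ φs → M ⊨ ⋁ φs at w → Any (λ φ → M ⊨ φ at w) φs
    ⋁-sat⁻ [] e = ⊥-elim (true≢false e (sat-⊥ᶠ M w))
    ⋁-sat⁻ (φ ∷ φs) e with ∨-true⁻ {sat M φ w} e
    ... | inj₁ eφ = here eφ
    ... | inj₂ eφs = there (⋁-sat⁻ φs eφs)

  ⋀-existential : ∀ {φs} → All Existential φs → Existential (⋀ φs)
  ⋀-existential [] = ex-disj (ex-atom p₀) (ex-neg p₀)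
  ⋀-existential (e ∷ es) = ex-conj e (⋀-existential es)

  ⋁-existential : ∀ {φs} → All Existential φs → Existential (⋁ φs)
  ⋁-existential [] = ex-conj (ex-atom p₀) (ex-neg p₀)
  ⋁-existential (e ∷ es) = ex-disj e (⋁-existential es)

  ⋀-depth : ∀ {n φs} → All (λ φ → depth φ ≤ n) φs → depth (⋀ φs) ≤ n
  ⋀-depth [] = z≤n
  ⋀-depth (e ∷ es) = ⊔-lub e (⋀-depth es)

  ⋁-depth : ∀ {n φs} → All (λ φ → depth φ ≤ n) φs → depth (⋁ φs) ≤ n
  ⋁-depth [] = z≤n
  ⋁-depth (e ∷ es) = ⊔-lub e (⋁-depth es)

  ◇≥ : ℕ → GML P → GML P
  ◇≥ zero φ = ⊤ᶠ
  ◇≥ (suc k) φ = dia (suc k) (s≤s z≤n) φ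

  sat-◇≥ : ∀ M k φ w → sat M (◇≥ k φ) w ≡ (k ≤ᵇ countTrue (λ u → R M w u ∧ sat M φ u))
  sat-◇≥ M zero φ w = sat-⊤ᶠ M w
  sat-◇≥ M (suc k) φ w = refl

  ◇≥-existential : ∀ k {φ} → Existential φ → Existential (◇≥ k φ)
  ◇≥-existential zero _ = ⋀-existential []
  ◇≥-existential (suc k) e = ex-dia (s≤s z≤n) e

  ◇≥-depth : ∀ k {n φ} → depth φ ≤ n → depth (◇≥ k φ) ≤ suc n
  ◇≥-depth zero _ = z≤n
  ◇≥-depth (suc k) le = s≤s le

  ⋁[_]_ : ∀ {k} → (Fin k → Bool) → (Fin k → GML P) → GML P
  ⋁[ S ] φ = ⋁ (List.tabulate (λ j → if S j then φ j else ⊥ᶠ))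

  sat-⋁[] : ∀ M {k} (S : Fin k → Bool) φ w → sat M (⋁[ S ] φ) w ≡ any (λ j → S j ∧ sat M (φ j) w)
  sat-⋁[] M S φ w = ⇔→≡ {z = true} (mk⇔ to from)
    where
      sat-if : ∀ b j → sat M (if b then φ j else ⊥ᶠ) w ≡ b ∧ sat M (φ j) w
      sat-if true j = refl
      sat-if false j = sat-⊥ᶠ M w
      to : sat M (⋁[ S ] φ) w ≡ true → any (λ j → S j ∧ sat M (φ j) w) ≡ true
      to e = let (j , eⱼ) = Anyₚ.tabulate⁻ (⋁-sat⁻ M w _ e) in
        any⁺ (λ j → S j ∧ sat M (φ j) w) (trans (sym (sat-if (S j) j)) eⱼ)
      from : any (λ j → S j ∧ sat M (φ j) w) ≡ true → sat M (⋁[ S ] φ) w ≡ true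
      from e = let (j , eⱼ) = any⁻ _ e in ⋁-sat⁺ M w (Anyₚ.tabulate⁺ j (trans (sat-if (S j) j) eⱼ))

  ⋁[]-existential : ∀ {k} (S : Fin k → Bool) {φ} → (∀ j → Existential (φ j)) → Existential (⋁[ S ] φ)
  ⋁[]-existential S e = ⋁-existential (Allₚ.tabulate⁺ (λ j → if-existential (S j) (e j)))
    where
      if-existential : ∀ b {ψ} → Existential ψ → Existential (if b then ψ else ⊥ᶠ)
      if-existential true e = e
      if-existential false _ = ⋁-existential []

  ⋁[]-depth : ∀ {k n} (S : Fin k → Bool) {φ} → (∀ j → depth (φ j) ≤ n) → depth (⋁[ S ] φ) ≤ n
  ⋁[]-depth S le = ⋁-depth (Allₚ.tabulate⁺ (λ j → if-depth (S j) (le j)))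
    where
      if-depth : ∀ {n} b {ψ} → depth ψ ≤ n → depth (if b then ψ else ⊥ᶠ) ≤ n
      if-depth true le = le
      if-depth false _ = z≤n

  literals : (Fin P → Bool) → GML P
  literals val = ⋀ (List.tabulate (λ p → if val p then atom p else neg (atom p)))

  literals-sat⁺ : ∀ M val w → (∀ p → val p ≡ V M p w) → M ⊨ literals val at w
  literals-sat⁺ M val w agree = ⋀-sat⁺ M w (Allₚ.tabulate⁺ literal)
    where
      literal : ∀ p → M ⊨ (if val p then atom p else neg (atom p)) at w
      literal p with val p | agree p
      ... | true | e = sym e
      ... | false | e = cong not (sym e)

  literals-sat⁻ : ∀ M val w → M ⊨ literals val at w → ∀ p → val p ≡ V M p w
  literals-sat⁻ M val w e p with val p | Allₚ.tabulate⁻ (⋀-sat⁻ M w _ e) p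
  ... | true | eₚ = sym eₚ
  ... | false | eₚ = sym (not-true⁻ eₚ)

  literals-existential : ∀ val → Existential (literals val)
  literals-existential val = ⋀-existential (Allₚ.tabulate⁺ literal)
    where
      literal : ∀ p → Existential (if val p then atom p else neg (atom p))
      literal p with val p
      ... | true = ex-atom p
      ... | false = ex-neg p

  literals-depth : ∀ {n} val → depth (literals val) ≤ n
  literals-depth {n} val = ⋀-depth (Allₚ.tabulate⁺ literal)
    where
      literal : ∀ p → depth (if val p then atom p else neg (atom p)) ≤ n
      literal p with val p
      ... | true = z≤n
      ... | false = z≤n

-- Trees and their diagrams

data Tree (P : ℕ) : ℕ → Set where
  leaf : Vec Bool P → Tree P zero
  node : ∀ {d} → Vec Bool P → List (Tree P d) → Tree P (suc d)

module _ {P : ℕ} where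

  point : (Fin P → Bool) → Model P
  point val = record { size = 0 ; R = λ _ _ → false ; V = λ p _ → val p }

  -- Children are attached one at a time, so the root always stays at index zero.
  mutual
    treeModel : ∀ {d} → Tree P d → Model P
    treeModel (leaf val) = nodeModel {zero} val []
    treeModel (node val cs) = nodeModel val cs

    nodeModel : ∀ {d} → Vec Bool P → List (Tree P d) → Model P
    nodeModel val [] = point (lookup val)
    nodeModel val (c ∷ cs) = attach (nodeModel val cs) (treeModel c)

  nodeModel-root-fresh : ∀ {d} val (cs : List (Tree P d)) y → R (nodeModel val cs) y zero ≡ false
  nodeModel-root-fresh val [] y = refl
  nodeModel-root-fresh val (c ∷ cs) =
    Attach.attach-root-fresh (nodeModel val cs) (treeModel c) (nodeModel-root-fresh val cs)

  nodeModel-root-V : ∀ {d} val (cs : List (Tree P d)) p → V (nodeModel val cs) p zero ≡ lookup val p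
  nodeModel-root-V val [] p = refl
  nodeModel-root-V val (c ∷ cs) p = nodeModel-root-V val cs p

  nodeModel-root-count : ∀ {d} val (cs : List (Tree P d)) χ →
    countTrue (λ w → R (nodeModel val cs) zero w ∧ sat (nodeModel val cs) χ w) ≡
    countTrue (λ j → sat (treeModel (List.lookup cs j)) χ zero)
  nodeModel-root-count val [] χ = refl
  nodeModel-root-count val (c ∷ cs) χ =
    trans (root-count χ) (trans (cong (_+ indicator (sat (treeModel c) χ zero)) (nodeModel-root-count val cs χ))
                                (+-comm _ (indicator (sat (treeModel c) χ zero))))
    where open Attach (nodeModel val cs) (treeModel c) (nodeModel-root-fresh val cs)

  Bounded : ℕ → ∀ {d} → Tree P d → Set
  Bounded B (leaf _) = ⊤
  Bounded B (node _ cs) = length cs ≤ B × All (Bounded B) cs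

  HomFrom : ∀ {d} → Tree P d → (N : Model P) → World N → Set
  HomFrom t N u = Σ (LocallyInjectiveHom (treeModel t) N) λ h → map h zero ≡ u

  node-hom : ∀ {d N} val (cs : List (Tree P d)) {u} {m : Fin (length cs) → World N} →
    (∀ p → lookup val p ≡ V N p u) → (∀ i j → m i ≡ m j → i ≡ j) → (∀ j → R N u (m j) ≡ true) →
    (∀ j → HomFrom (List.lookup cs j) N (m j)) →
    Σ (LocallyInjectiveHom (nodeModel val cs) N) λ h → map h zero ≡ u ×
      (∀ w → R (nodeModel val cs) zero w ≡ true → ∃ λ j → map h w ≡ m j)
  node-hom val [] {u} agree _ _ _ =
    record { map = λ _ → u ; preserves-V = λ p _ → agree p ; preserves-R = λ _ _ ()
           ; locally-injective = λ _ _ _ () } ,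
    refl , λ _ ()
  node-hom {N = N} val (c ∷ cs) {m = m} agree m-injective edges children
    with node-hom val cs agree (λ i j e → suc-injective (m-injective (suc i) (suc j) e))
                  (edges ∘ suc) (children ∘ suc)
       | children zero
  ... | hA , refl , hA-successors | hC , hC-root =
    attach-hom hA hC (subst (λ z → R N (map hA zero) z ≡ true) (sym hC-root) (edges zero)) fresh ,
    refl , root-successor-image
    where
      open Attach (nodeModel val cs) (treeModel c) (nodeModel-root-fresh val cs)
      fresh : ∀ y → R (nodeModel val cs) zero y ≡ true → map hA y ≢ map hC zero
      fresh y e eq with hA-successors y e
      ... | j , eⱼ = case m-injective (suc j) zero (trans (sym eⱼ) (trans eq hC-root)) of λ ()
      root-successor-image : ∀ w → R X zero w ≡ true → ∃ λ j → either (map hA) (map hC) w ≡ m j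
      root-successor-image w e with root-successor w e
      ... | inj₁ (y , e′ , refl) =
        let (j , eⱼ) = hA-successors y e′ in suc j , trans (either-inl (map hA) (map hC) y) eⱼ
      ... | inj₂ refl = zero , trans (either-inr (map hA) (map hC) zero) hC-root

trees : ∀ {P} → ℕ → (d : ℕ) → List (Tree P d)
trees {P} B zero = List.map leaf (allVecs P)
trees {P} B (suc d) = cartesianProductWith node (allVecs P) (listsUpTo B (trees B d))

trees-complete : ∀ {P} B {d} (t : Tree P d) → Bounded B t → t ∈ trees B d
trees-complete B (leaf val) _ = ∈-map⁺ leaf (allVecs-complete val)
trees-complete B (node val cs) (len≤ , bounded) = ∈-cartesianProductWith⁺ node (allVecs-complete val)
  (listsUpTo-complete B len≤ (All.map (λ {t} → trees-complete B t) bounded))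

module Diagrams {P : ℕ} (p₀ : Fin P) where
  open Connectives p₀

  hallClause : ∀ {k} → (Fin k → GML P) → Vec Bool k → GML P
  hallClause φ S = ◇≥ (countTrue (lookup S)) (⋁[ lookup S ] φ)

  -- The clauses for all sets S of children say that N satisfies Hall's condition for matching
  -- the children to successors satisfying their diagrams.
  diagram : ∀ {d} → Tree P d → GML P
  diagram (leaf val) = literals (lookup val)
  diagram (node val cs) = conj (literals (lookup val))
    (⋀ (List.map (hallClause (λ j → diagram (List.lookup cs j))) (allVecs (length cs))))

  diagram-existential : ∀ {d} (t : Tree P d) → Existential (diagram t)
  diagram-existential (leaf val) = literals-existential (lookup val)
  diagram-existential (node val cs) = ex-conj (literals-existential (lookup val)) (⋀-existential (Allₚ.map⁺
    (All.universal (λ S → ◇≥-existential (countTrue (lookup S))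
                             (⋁[]-existential (lookup S) (λ j → diagram-existential (List.lookup cs j))))
                   (allVecs (length cs)))))

  diagram-depth : ∀ {d} (t : Tree P d) → depth (diagram t) ≤ d
  diagram-depth (leaf val) = literals-depth (lookup val)
  diagram-depth (node val cs) = ⊔-lub (literals-depth (lookup val)) (⋀-depth (Allₚ.map⁺
    (All.universal (λ S → ◇≥-depth (countTrue (lookup S))
                             (⋁[]-depth (lookup S) (λ j → diagram-depth (List.lookup cs j))))
                   (allVecs (length cs)))))

  diagram⇒hom : ∀ {d} (t : Tree P d) {N} u → N ⊨ diagram t at u → HomFrom t N u
  diagram⇒hom (leaf val) {N} u e =
    let (h , h-root , _) =
          node-hom {d = zero} {N} val [] {m = λ ()} (literals-sat⁻ N (lookup val) u e) (λ ()) (λ ()) (λ ())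
    in h , h-root
  diagram⇒hom (node val cs) {N} u e =
    let (h , h-root , _) = node-hom val cs (literals-sat⁻ N (lookup val) u (∧-true⁻ˡ e))
                             (λ i j → injective matching i j refl refl)
                             (λ j → ∧-true⁻ˡ (adjacent matching j refl))
                             (λ j → diagram⇒hom (List.lookup cs j) (match matching j)
                                      (∧-true⁻ʳ {R N u (match matching j)} (adjacent matching j refl)))
    in h , h-root
    where
      φ : Fin (length cs) → GML P
      φ j = diagram (List.lookup cs j)
      Adj : Fin (length cs) → World N → Bool
      Adj j y = R N u y ∧ sat N (φ j) y
      clauses : All (λ S → N ⊨ hallClause φ S at u) (allVecs (length cs))
      clauses = Allₚ.map⁻ (⋀-sat⁻ N u _ (∧-true⁻ʳ {sat N (literals (lookup val)) u} e))
      ∧-swap : ∀ a b c → a ∧ (b ∧ c) ≡ b ∧ (a ∧ c)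
      ∧-swap true b c = refl
      ∧-swap false b c = sym (∧-zeroʳ b)
      successors-in-neighbours : ∀ S y →
        R N u y ∧ sat N (⋁[ lookup (tabulate S) ] φ) y ≡ neighbours Adj S y
      successors-in-neighbours S y = begin
        R N u y ∧ sat N (⋁[ lookup (tabulate S) ] φ) y
          ≡⟨ cong (R N u y ∧_) (sat-⋁[] N (lookup (tabulate S)) φ y) ⟩
        R N u y ∧ any (λ j → lookup (tabulate S) j ∧ sat N (φ j) y)
          ≡⟨ cong (R N u y ∧_) (any-cong (λ j → cong (_∧ sat N (φ j) y) (lookup∘tabulate S j))) ⟩
        R N u y ∧ any (λ j → S j ∧ sat N (φ j) y)
          ≡⟨ any-∧ˡ (R N u y) (λ j → S j ∧ sat N (φ j) y) ⟨
        any (λ j → R N u y ∧ (S j ∧ sat N (φ j) y))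
          ≡⟨ any-cong (λ j → ∧-swap (R N u y) (S j) (sat N (φ j) y)) ⟩
        neighbours Adj S y ∎
        where open ≡-Reasoning
      hall-condition : HallCondition Adj (λ _ → true)
      hall-condition S _ =
        subst₂ _≤_ (countTrue-cong (lookup∘tabulate S)) (countTrue-cong (successors-in-neighbours S))
          (≤ᵇ-true⁻ {|S|} (trans (sym (sat-◇≥ N |S| (⋁[ lookup (tabulate S) ] φ) u))
                                (All.lookup clauses (allVecs-complete (tabulate S)))))
        where
          |S| : ℕ
          |S| = countTrue (lookup (tabulate S))
      matching : Matching Adj (λ _ → true)
      matching = hall _ Adj ≤-refl hall-condition

-- Unravelling

diamonds : ∀ {P} → GML P → List (ℕ × GML P)
diamonds (atom p) = []
diamonds (neg φ) = diamonds φ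
diamonds (conj φ ψ) = diamonds φ List.++ diamonds ψ
diamonds (disj φ ψ) = diamonds φ List.++ diamonds ψ
diamonds (dia k _ φ) = (k , φ) ∷ diamonds φ

module Unravelling {P} (N : Model P) (ds : List (ℕ × GML P)) where

  successorsWith : World N → GML P → World N → Bool
  successorsWith u χ y = R N u y ∧ sat N χ y

  selectedBy : List (ℕ × GML P) → World N → World N → Bool
  selectedBy [] u y = false
  selectedBy ((k , χ) ∷ es) u y = firstTrue k (successorsWith u χ) y ∨ selectedBy es u y

  selectedBy⇒successor : ∀ es {u y} → selectedBy es u y ≡ true → R N u y ≡ true
  selectedBy⇒successor ((k , χ) ∷ es) {u} {y} e with ∨-true⁻ {firstTrue k (successorsWith u χ) y} e
  ... | inj₁ e₁ = ∧-true⁻ˡ (firstTrue-⊆ k (successorsWith u χ) y e₁)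
  ... | inj₂ e₂ = selectedBy⇒successor es e₂

  selectedBy-count : ∀ es u → countTrue (selectedBy es u) ≤ sum (List.map proj₁ es)
  selectedBy-count [] u = ≤-reflexive (countTrue-≡0 {f = selectedBy [] u} (λ _ → refl))
  selectedBy-count ((k , χ) ∷ es) u = ≤-trans (countTrue-∨ (firstTrue k (successorsWith u χ)) (selectedBy es u))
    (+-mono-≤ (subst (_≤ k) (sym (countTrue-firstTrue k (successorsWith u χ))) (m⊓n≤m k _)) (selectedBy-count es u))

  selectedBy-enough : ∀ es {k χ} u → (k , χ) ∈ es → k ≤ countTrue (successorsWith u χ) →
    k ≤ countTrue (λ y → selectedBy es u y ∧ sat N χ y)
  selectedBy-enough ((k , χ) ∷ es) u (here refl) k≤ = begin
    k                                                   ≡⟨ m≤n⇒m⊓n≡m k≤ ⟨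
    k ⊓ countTrue (successorsWith u χ)                  ≡⟨ countTrue-firstTrue k (successorsWith u χ) ⟨
    countTrue (firstTrue k (successorsWith u χ))
      ≤⟨ countTrue-mono _ _ (λ y e → ∧-true⁺ (∨-true⁺ˡ {b = selectedBy es u y} e)
                                              (∧-true⁻ʳ {R N u y} (firstTrue-⊆ k (successorsWith u χ) y e))) ⟩
    countTrue (λ y → selectedBy ((k , χ) ∷ es) u y ∧ sat N χ y) ∎
    where open ≤-Reasoning
  selectedBy-enough ((k′ , χ′) ∷ es) {χ = χ} u (there k,χ∈es) k≤ = ≤-trans (selectedBy-enough es u k,χ∈es k≤)
    (countTrue-mono (λ y → selectedBy es u y ∧ sat N χ y) (λ y → selectedBy ((k′ , χ′) ∷ es) u y ∧ sat N χ y)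
       (λ y e → ∧-true⁺ (∨-true⁺ʳ {firstTrue k′ (successorsWith u χ′) y} (∧-true⁻ˡ e)) (∧-true⁻ʳ {selectedBy es u y} e)))

  selected : World N → World N → Bool
  selected = selectedBy ds

  valuation : World N → Vec Bool P
  valuation u = tabulate (λ p → V N p u)

  unravel : (d : ℕ) → World N → Tree P d
  unravel zero u = leaf (valuation u)
  unravel (suc d) u = node (valuation u) (pick (selected u) (unravel d))

  unravel-root-V : ∀ d u p → V (treeModel (unravel d u)) p zero ≡ V N p u
  unravel-root-V zero u p = lookup∘tabulate (λ q → V N q u) p
  unravel-root-V (suc d) u p =
    trans (nodeModel-root-V (valuation u) (pick (selected u) (unravel d)) p) (lookup∘tabulate (λ q → V N q u) p)

  unravel-bounded : ∀ d u → Bounded (sum (List.map proj₁ ds)) (unravel d u)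
  unravel-bounded zero u = tt
  unravel-bounded (suc d) u =
    subst (_≤ _) (sym (length-pick (selected u) (unravel d))) (selectedBy-count ds u) ,
    All-pick (selected u) (unravel d) (unravel-bounded d)

  unravel-sat : ∀ d u χ → (∀ e → e ∈ diamonds χ → e ∈ ds) → depth χ ≤ d →
    sat (treeModel (unravel d u)) χ zero ≡ sat N χ u
  unravel-sat d u (atom p) _ _ = unravel-root-V d u p
  unravel-sat d u (neg χ) sub le = cong not (unravel-sat d u χ sub le)
  unravel-sat d u (conj χ ψ) sub le = cong₂ _∧_
    (unravel-sat d u χ (λ e → sub e ∘ ∈-++⁺ˡ) (m⊔n≤o⇒m≤o (depth χ) (depth ψ) le))
    (unravel-sat d u ψ (λ e → sub e ∘ ∈-++⁺ʳ (diamonds χ)) (m⊔n≤o⇒n≤o (depth χ) (depth ψ) le))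
  unravel-sat d u (disj χ ψ) sub le = cong₂ _∨_
    (unravel-sat d u χ (λ e → sub e ∘ ∈-++⁺ˡ) (m⊔n≤o⇒m≤o (depth χ) (depth ψ) le))
    (unravel-sat d u ψ (λ e → sub e ∘ ∈-++⁺ʳ (diamonds χ)) (m⊔n≤o⇒n≤o (depth χ) (depth ψ) le))
  unravel-sat (suc d) u (dia k _ χ) sub (s≤s le) = begin
    k ≤ᵇ countTrue (λ w → R (nodeModel (valuation u) cs) zero w ∧ sat (nodeModel (valuation u) cs) χ w)
      ≡⟨ cong (k ≤ᵇ_) (nodeModel-root-count (valuation u) cs χ) ⟩
    k ≤ᵇ countTrue (λ j → sat (treeModel (List.lookup cs j)) χ zero)
      ≡⟨ cong (k ≤ᵇ_) (countTrue-≡-bijection ι into (λ i j _ _ → pickIndex-injective (selected u) (unravel d) i j)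
                                              onto) ⟩
    k ≤ᵇ countTrue (λ y → selected u y ∧ sat N χ y)
      ≡⟨ ≤ᵇ-threshold (countTrue-mono (λ y → selected u y ∧ sat N χ y) (successorsWith u χ)
                         (λ y e → ∧-true⁺ (selectedBy⇒successor ds (∧-true⁻ˡ e)) (∧-true⁻ʳ {selected u y} e)))
                      (selectedBy-enough ds u (sub (k , χ) (here refl))) ⟩
    k ≤ᵇ countTrue (successorsWith u χ) ∎
    where
      open ≡-Reasoning
      cs : List (Tree P d)
      cs = pick (selected u) (unravel d)
      ι : Fin (length cs) → World N
      ι = pickIndex (selected u) (unravel d)
      child-sat : ∀ j → sat (treeModel (List.lookup cs j)) χ zero ≡ sat N χ (ι j)
      child-sat j = trans (cong (λ t → sat (treeModel t) χ zero) (lookup-pick (selected u) (unravel d) j))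
                          (unravel-sat d (ι j) χ (λ e → sub e ∘ there) le)
      into : ∀ j → sat (treeModel (List.lookup cs j)) χ zero ≡ true → selected u (ι j) ∧ sat N χ (ι j) ≡ true
      into j e = ∧-true⁺ (pickIndex-picked (selected u) (unravel d) j) (trans (sym (child-sat j)) e)
      onto : ∀ y → selected u y ∧ sat N χ y ≡ true →
        ∃ λ j → sat (treeModel (List.lookup cs j)) χ zero ≡ true × ι j ≡ y
      onto y e = let (j , ιj≡y) = pickIndex-surjective (selected u) (unravel d) y (∧-true⁻ˡ e) in
        j , trans (child-sat j) (trans (cong (sat N χ) ιj≡y) (∧-true⁻ʳ {selected u y} e)) , ιj≡y

  module _ (p₀ : Fin P) where
    open Connectives p₀
    open Diagrams p₀

    unravel-diagram : ∀ d u → N ⊨ diagram (unravel d u) at u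
    unravel-diagram zero u = literals-sat⁺ N _ u (λ p → lookup∘tabulate (λ q → V N q u) p)
    unravel-diagram (suc d) u = ∧-true⁺ (literals-sat⁺ N _ u (λ p → lookup∘tabulate (λ q → V N q u) p))
      (⋀-sat⁺ N u (Allₚ.map⁺ (All.universal clause (allVecs (length cs)))))
      where
        cs : List (Tree P d)
        cs = pick (selected u) (unravel d)
        ι : Fin (length cs) → World N
        ι = pickIndex (selected u) (unravel d)
        φ : Fin (length cs) → GML P
        φ j = diagram (List.lookup cs j)
        child-diagram : ∀ j → N ⊨ φ j at ι j
        child-diagram j =
          subst (λ t → N ⊨ diagram t at ι j) (sym (lookup-pick (selected u) (unravel d) j)) (unravel-diagram d (ι j))
        clause : ∀ S → N ⊨ hallClause φ S at u
        clause S = trans (sat-◇≥ N (countTrue (lookup S)) (⋁[ lookup S ] φ) u) (≤ᵇ-true⁺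
          (countTrue-≤-injection {Q = λ y → R N u y ∧ sat N (⋁[ lookup S ] φ) y} (λ j _ → ι j)
            (λ j Sⱼ → ∧-true⁺ (selectedBy⇒successor ds (pickIndex-picked (selected u) (unravel d) j))
                               (trans (sat-⋁[] N (lookup S) φ (ι j))
                                      (any⁺ (λ i → lookup S i ∧ sat N (φ i) (ι j)) (∧-true⁺ Sⱼ (child-diagram j)))))
            (λ i j _ _ → pickIndex-injective (selected u) (unravel d) i j)))

firstAtom : ∀ {P} → GML P → Fin P
firstAtom (atom p) = p
firstAtom (neg φ) = firstAtom φ
firstAtom (conj φ _) = firstAtom φ
firstAtom (disj φ _) = firstAtom φ
firstAtom (dia _ _ φ) = firstAtom φ

module Characterisation {P} (φ : GML P) (L : ℕ) where
  open Connectives (firstAtom φ)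
  open Diagrams (firstAtom φ)

  B : ℕ
  B = sum (List.map proj₁ (diamonds φ))

  root-sat? : (t : Tree P L) → Dec (treeModel t ⊨ φ at zero)
  root-sat? t = sat (treeModel t) φ zero Bool.≟ true

  φ-trees : List (Tree P L)
  φ-trees = filter root-sat? (trees B L)

  ψ : GML P
  ψ = ⋁ (List.map diagram φ-trees)

  ψ-existential : Existential ψ
  ψ-existential = ⋁-existential (Allₚ.map⁺ (All.universal diagram-existential φ-trees))

  ψ-depth : depth ψ ≤ L
  ψ-depth = ⋁-depth (Allₚ.map⁺ (All.universal diagram-depth φ-trees))

  φ⇒ψ : depth φ ≤ L → ∀ M w → M ⊨ φ at w → M ⊨ ψ at w
  φ⇒ψ φ≤L M w Mφ = ⋁-sat⁺ M w (Anyₚ.map⁺ (lose t∈φ-trees (unravel-diagram (firstAtom φ) L w)))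
    where
      open Unravelling M (diamonds φ)
      t : Tree P L
      t = unravel L w
      t∈φ-trees : t ∈ φ-trees
      t∈φ-trees = ∈-filter⁺ root-sat? (trees-complete B t (unravel-bounded L w))
                    (trans (unravel-sat L w φ (λ _ e∈ → e∈) φ≤L) Mφ)

  ψ⇒φ : PreservedUnderEmbeddings φ → ∀ M w → M ⊨ ψ at w → M ⊨ φ at w
  ψ⇒φ preserved M w Mψ with find (Anyₚ.map⁻ {f = diagram} {xs = φ-trees} (⋁-sat⁻ M w (List.map diagram φ-trees) Mψ))
  ... | t , t∈φ-trees , Mdiagram with diagram⇒hom t w Mdiagram
  ...   | h , h-root = subst (λ u → M ⊨ φ at u) h-root (preserved-along-hom {φ = φ} preserved h zero tφ)
    where
      tφ : treeModel t ⊨ φ at zero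
      tφ = proj₂ (∈-filter⁻ root-sat? {xs = trees B L} t∈φ-trees)

theorem4p4 : ∀ {P : ℕ} (L : ℕ) (φ : GML P) → depth φ ≤ L →
    (PreservedUnderEmbeddings φ ⇔
      Σ (GML P) (λ ψ → Existential ψ × depth ψ ≤ L × Equivalent φ ψ))
theorem4p4 L φ φ≤L = mk⇔
  (λ preserved → ψ , ψ-existential , ψ-depth ,
     λ M w → ⇔→≡ {z = true} (mk⇔ (φ⇒ψ φ≤L M w) (ψ⇒φ preserved M w)))
  (λ (χ , χ-existential , _ , φ≡χ) → existential-equivalent⇒preserved {φ = φ} χ-existential φ≡χ)
  where open Characterisation φ L
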